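{- Let $n\ge 1$, let $\mathbf{k}=(k_1,\ldots,k_n)$ be a tuple of positive integers and $K=k_1+\cdots+k_n$. Then: (1) $B_{\mathbf{k}}(m)$ and $b_{\mathbf{k}}(m)$ are polynomials in $m$ of degree $K$, both with leading coefficient $|\mathcal{SP}_{\mathbf{k}}|/K!$; moreover $B_{\mathbf{k}}(0)=B_{\mathbf{k}}(-1)=\cdots=B_{\mathbf{k}}(-K+n)=0$ and $B_{\mathbf{k}}(m)=(-1)^K b_{\mathbf{k}}(-m)$ (as polynomials). (2) If $k_n>1$, then for every positive integer $m$, $$B_{\mathbf{k}}(m)=\sum_{i=0}^{m} i\,B_{\mathbf{k}\setminus k_n}(i)\binom{k_n+m-i-2}{k_n-2},\qquad b_{\mathbf{k}}(m)=\sum_{i=0}^{m-1} i\,b_{\mathbf{k}\setminus k_n}(i)\binom{m-i-1}{k_n-2},$$ where $\mathbf{k}\setminus k_n=(k_1,\ldots,k_{n-1})$. (3) $B_{\emptyset}(m)=1$, $B_{\mathbf{k}}(0)=0$, and for every positive integer $m$: $B_{\mathbf{k}}(m)=B_{\mathbf{k}}(m-1)+B_{\mathbf{k}'}(m)$ if $k_n>1$, and $B_{\mathbf{k}}(m)=m\,B_{\mathbf{k}'}(m)$ if $k_n=1$. (4) $b_{\emptyset}(m)=1$, $b_{\mathbf{k}}(0)=0$, and for every positive integer $m$: $b_{\mathbf{k}}(m)=b_{\mathbf{k}}(m-1)+b_{\mathbf{k}'}(m-1)$ if $k_n>1$, and $b_{\mathbf{k}}(m)=m\,b_{\mathbf{k}'}(m)$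 if $k_n=1$. Here $\mathbf{k}'=(k_1,\ldots,k_{n-1},k_n-1)$, where a tuple whose last entry is $0$ is identified with the tuple obtained by deleting that entry.
   Context: For a tuple $\mathbf{k}=(k_1,\ldots,k_n)$ of positive integers, $K=k_1+\cdots+k_n$, consider the multiset $\{1^{k_1},\ldots,n^{k_n}\}$ ($k_i$ copies of $i$). A Stirling permutation of it is a word $\sigma=\sigma(1)\cdots\sigma(K)$ containing each $i$ exactly $k_i$ times such that whenever $\sigma(i)=\sigma(j)$ and $i<s<j$, one has $\sigma(s)\ge\sigma(i)$. $\mathcal{SP}_{\mathbf{k}}$ denotes the set of Stirling permutations. An index $i\in\{1,\ldots,K\}$ is a descent of $\sigma$ if either $i<K$ and $\sigma(i)>\sigma(i+1)$, or $i=K$. $A_{\mathbf{k},i}$ is the number of $\sigma\in\mathcal{SP}_{\mathbf{k}}$ with exactly $i$ descents. Define the formal power series $$G_{\mathbf{k}}(x)=\frac{\sum_{i=1}^{n}A_{\mathbf{k},i}x^i}{(1-x)^{K+1}}=\sum_{m\ge0}B_{\mathbf{k}}(m)x^m,\qquad g_{\mathbf{k}}(x)=\frac{\sum_{i=K-n+1}^{K}A_{\mathbf{k},K+1-i}x^i}{(1-x)^{K+1}}=\sum_{m\ge0}b_{\mathbf{k}}(m)x^m.$$ For the empty tuple, $B_\emptyset(m)=b_\emptyset(m)=1$ by convention. -}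

module Defs where

open import Data.Bool.Base using (Bool; true; false; _∧_; _∨_; not; if_then_else_)
open import Data.Nat.Base using (ℕ; zero; suc; _+_; _*_; _∸_; _≤ᵇ_; _<ᵇ_; _!)
open import Data.Nat.Properties using (_!≢0)
open import Data.Nat.Combinatorics using (_C_)
open import Data.List.Base using (List; []; _∷_; _∷ʳ_; length; map; concatMap; upTo; foldr)
open import Data.Nat.ListAction using (sum)
open import Data.Product.Base using (Σ; _×_)
open import Relation.Binary.PropositionalEquality using (_≡_)
open import Relation.Nullary using (¬_)
open import Data.Integer.Base using (+_)
open import Data.Rational.Base using (ℚ; _/_; -_; 0ℚ) renaming (_+_ to _+ℚ_; _*_ to _*ℚ_)

-- Basic helpers (all indices into lists are 0-based; letters are 1..n)

_==_ : ℕ → ℕ → Bool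
m == n = (m ≤ᵇ n) ∧ (n ≤ᵇ m)

at : List ℕ → ℕ → ℕ
at []       _       = 0
at (x ∷ xs) zero    = x
at (x ∷ xs) (suc i) = at xs i

occ : ℕ → List ℕ → ℕ
occ a []       = 0
occ a (x ∷ xs) = (if a == x then 1 else 0) + occ a xs

countᵇ : {A : Set} → (A → Bool) → List A → ℕ
countᵇ p []       = 0
countᵇ p (x ∷ xs) = (if p x then 1 else 0) + countᵇ p xs

all : {A : Set} → (A → Bool) → List A → Bool
all p []       = true
all p (x ∷ xs) = p x ∧ all p xs

sumTo : ℕ → (ℕ → ℕ) → ℕ
sumTo m f = sum (map f (upTo (suc m)))

-- Tuples k = (k_1,…,k_n) are lists of naturals; n = length k, K = sum k.

words : ℕ → ℕ → List (List ℕ)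
words n zero    = [] ∷ []
words n (suc L) = concatMap (λ a → map (suc a ∷_) (words n L)) (upTo n)

hasMultiset : List ℕ → List ℕ → Bool
hasMultiset k w = all (λ i → occ (suc i) w == at k i) (upTo (length k))

stirlingCond : List ℕ → Bool
stirlingCond w =
  all (λ i → all (λ j → all (λ s →
        not ((i <ᵇ s) ∧ (s <ᵇ j) ∧ (at w i == at w j)) ∨ (at w i ≤ᵇ at w s))
      (upTo K)) (upTo K)) (upTo K)
  where K = length w

isSP : List ℕ → List ℕ → Bool
isSP k w = hasMultiset k w ∧ stirlingCond w

SP : List ℕ → List (List ℕ)
SP k = foldr (λ w r → if isSP k w then w ∷ r else r) [] (words (length k) (sum k))

-- number of descents: positions p (1-based p+1) with p+1 = K or w(p) > w(p+1)
des : List ℕ → ℕ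
des w = countᵇ (λ p → (suc p == K) ∨ (at w (suc p) <ᵇ at w p)) (upTo K)
  where K = length w

A : List ℕ → ℕ → ℕ
A k i = countᵇ (λ w → des w == i) (SP k)

-- coefficient of x^m in  (Σ_i p_i x^i) / (1-x)^{K+1},
-- using 1/(1-x)^{K+1} = Σ_j C(j+K,K) x^j
coeffDiv : (ℕ → ℕ) → ℕ → ℕ → ℕ
coeffDiv p K m = sumTo m (λ i → p i * ((m ∸ i + K) C K))

-- numerator of G_k : Σ_{i=1}^{n} A_{k,i} x^i
numG : List ℕ → ℕ → ℕ
numG k i = if (1 ≤ᵇ i) ∧ (i ≤ᵇ length k) then A k i else 0

-- numerator of g_k : Σ_{i=K-n+1}^{K} A_{k,K+1-i} x^i
numg : List ℕ → ℕ → ℕ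
numg k i = if (suc (sum k ∸ length k) ≤ᵇ i) ∧ (i ≤ᵇ sum k) then A k (suc (sum k) ∸ i) else 0

B : List ℕ → ℕ → ℕ
B []        m = 1
B k@(_ ∷ _) m = coeffDiv (numG k) (sum k) m

b : List ℕ → ℕ → ℕ
b []        m = 1
b k@(_ ∷ _) m = coeffDiv (numg k) (sum k) m

-- Polynomials over ℚ as coefficient lists [c_0, c_1, …, c_d]

fromℕℚ : ℕ → ℚ
fromℕℚ n = + n / 1

evalPoly : List ℚ → ℚ → ℚ
evalPoly []       x = + 0 / 1
evalPoly (c ∷ cs) x = c +ℚ (x *ℚ evalPoly cs x)

signℚ : ℕ → ℚ
signℚ zero    = + 1 / 1
signℚ (suc n) = - signℚ n

leadCoeff : List ℕ → ℚ
leadCoeff k = (+ length (SP k) / (sum k !)) {{sum k !≢0}}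

IsPolyDegLead : ℕ → ℚ → List ℚ → Set
IsPolyDegLead d c P = Σ (List ℚ) (λ cs → (P ≡ cs ∷ʳ c) × (length cs ≡ d) × (¬ c ≡ 0ℚ))

module Submission where

-- Every Stirling permutation of (k₁,…,kₙ,kₙ₊₁) arises in exactly one way by inserting the block
-- (n+1)^kₙ₊₁ of the new largest letter into one of the K + 1 gaps of a Stirling permutation of
-- (k₁,…,kₙ), where K = k₁ + ⋯ + kₙ; the insertion keeps the number of descents if the gap is a
-- descent and adds one otherwise. Hence A_{k′,j+1} = (j+1) A_{k,j+1} + (K+1-j) A_{k,j}. As
-- B_k(m) = Σᵢ A_{k,i} C(m-i+K, K) is a convolution, this recursion becomes Pascal's rule when
-- kₙ₊₁ > 1 and the operator x d/dx when kₙ₊₁ = 1, which gives (3), (4), and by iteration (2).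
-- For (1), C(m-i+K, K) is the polynomial (m-i+1)⋯(m-i+K)/K!, whose roots i-K, …, i-1 account for
-- the vanishing of B_k; its leading coefficient sums to |SP_k|/K!, and the symmetry
-- (-y-K)⋯(-y-1) = (-1)^K (y+1)⋯(y+K) exchanges B_k and b_k, whose numerators are each other's reverse.

open import Defs

module Combinatorics where

  open import Data.Bool.Base using (Bool; true; false; T; not; _∧_; _∨_; if_then_else_)
  open import Data.Bool.Properties using (T-∧; T?)
  open import Data.Nat.Base
  open import Data.Nat.Properties
  open import Data.Nat.Combinatorics using (_C_; nCn≡1; nCk+nC[k+1]≡[n+1]C[k+1])
  open import Data.Nat.ListAction using (sum)
  open import Data.Nat.ListAction.Properties using (sum-++)
  open import Data.Nat.Solver using (module +-*-Solver)
  open import Data.List.Base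
    using (List; []; _∷_; _∷ʳ_; _++_; length; replicate; take; drop; map; concatMap; upTo; applyUpTo; foldr; filter; cartesianProductWith)
  open import Data.List.Properties
    using ( length-++; length-++-≤ˡ; length-replicate; length-take; length-drop; length-map; length-upTo; take++drop≡id
          ; ++-identityʳ; map-++; map-∘; map-cong-local; map-upTo; map-applyUpTo; upTo-∷ʳ; filter-++; filter-all; filter-none)
  open import Data.List.Reverse using (Reverse; []; _∶_∶ʳ_; reverseView)
  open import Data.List.Membership.Propositional using (_∈_; find; lose)
  open import Data.List.Membership.Propositional.Properties
    using (∈-upTo⁺; ∈-upTo⁻; ∈-map⁺; ∈-map⁻; ∈-concatMap⁺; ∈-concatMap⁻; ∈-filter⁺; ∈-filter⁻)
  open import Data.List.Membership.Propositional.Properties.WithK using (unique∧set⇒bag)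
  open import Data.List.Membership.DecPropositional _≟_ using (_∈?_)
  open import Data.List.Relation.Unary.Any using (here; there)
  open import Data.List.Relation.Unary.All as All using (All; []; _∷_)
  import Data.List.Relation.Unary.All.Properties as Allₚ
  open import Data.List.Relation.Unary.All.Properties using (¬Any⇒All¬)
  open import Data.List.Relation.Unary.AllPairs using ([]; _∷_)
  open import Data.List.Relation.Unary.Unique.Propositional using (Unique)
  import Data.List.Relation.Unary.Unique.Propositional.Properties as Unique
  open import Data.List.Relation.Binary.BagAndSetEquality using (∼bag⇒↭)
  open import Data.List.Relation.Binary.Permutation.Propositional as ↭ using (_↭_)
  open import Data.List.Relation.Binary.Permutation.Propositional.Properties using (↭-length)
  open import Data.Product.Base using (∃; ∃₂; _×_; _,_; proj₁; proj₂)
  open import Data.Sum.Base using (_⊎_; inj₁; inj₂)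
  open import Algebra.Properties.CommutativeSemigroup +-commutativeSemigroup using (x∙yz≈y∙xz; interchange)
  open import Function.Base using (_∘_)
  open import Function.Bundles using (Equivalence; mk⇔)
  open import Relation.Binary.Definitions using (tri<; tri≈; tri>)
  open import Relation.Binary.PropositionalEquality as ≡ using (_≡_; _≢_; refl; cong; cong₂; subst; subst₂; sym; trans)
  open import Relation.Nullary.Decidable using (Dec; yes; no; ¬?)
  open import Relation.Nullary.Negation using (¬_; contradiction)
  open import Relation.Nullary.Reflects using (Reflects; ofʸ; ofⁿ; fromEquivalence; _×-reflects_; _→-reflects_)
  open +-*-Solver using (solve; _:+_; _:*_; _:=_; con)

  reflects-true : ∀ {P : Set} {b} → Reflects P b → P → b ≡ true
  reflects-true (ofʸ _) _ = refl
  reflects-true (ofⁿ ¬a) a = contradiction a ¬a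

  reflects-false : ∀ {P : Set} {b} → Reflects P b → ¬ P → b ≡ false
  reflects-false (ofʸ a) ¬a = contradiction a ¬a
  reflects-false (ofⁿ _) _ = refl

  reflects-toT : ∀ {P : Set} {b} → Reflects P b → P → T b
  reflects-toT (ofʸ _)  _ = _
  reflects-toT (ofⁿ ¬a) a = contradiction a ¬a

  reflects-fromT : ∀ {P : Set} {b} → Reflects P b → T b → P
  reflects-fromT (ofʸ a) _ = a

  ==-reflects-≡ : ∀ m n → Reflects (m ≡ n) (m == n)
  ==-reflects-≡ m n = fromEquivalence
    (λ t → let m≤n , n≤m = Equivalence.to T-∧ t in ≤-antisym (≤ᵇ⇒≤ m n m≤n) (≤ᵇ⇒≤ n m n≤m))
    (λ { refl → Equivalence.from (T-∧ {m ≤ᵇ m}) (≤⇒≤ᵇ (≤-refl {m}) , ≤⇒≤ᵇ (≤-refl {m})) })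

  ==-refl : ∀ m → (m == m) ≡ true
  ==-refl m = reflects-true (==-reflects-≡ m m) refl

  ≢⇒==-false : ∀ {m n} → m ≢ n → (m == n) ≡ false
  ≢⇒==-false = reflects-false (==-reflects-≡ _ _)

  ==-suc : ∀ m n → (suc m == suc n) ≡ (m == n)
  ==-suc m n with m == n | ==-reflects-≡ m n
  ... | true  | ofʸ refl = ==-refl (suc m)
  ... | false | ofⁿ m≢n = ≢⇒==-false (m≢n ∘ suc-injective)

  ≤ᵇ-true : ∀ {m n} → m ≤ n → (m ≤ᵇ n) ≡ true
  ≤ᵇ-true = reflects-true (≤ᵇ-reflects-≤ _ _)

  ≤ᵇ-false : ∀ {m n} → ¬ m ≤ n → (m ≤ᵇ n) ≡ false
  ≤ᵇ-false = reflects-false (≤ᵇ-reflects-≤ _ _)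

  <ᵇ-true : ∀ {m n} → m < n → (m <ᵇ n) ≡ true
  <ᵇ-true = reflects-true (<ᵇ-reflects-< _ _)

  <ᵇ-false : ∀ {m n} → ¬ m < n → (m <ᵇ n) ≡ false
  <ᵇ-false = reflects-false (<ᵇ-reflects-< _ _)

  reflects-⇔ : ∀ {P Q : Set} {b} → (P → Q) → (Q → P) → Reflects P b → Reflects Q b
  reflects-⇔ to from (ofʸ p)  = ofʸ (to p)
  reflects-⇔ to from (ofⁿ ¬p) = ofⁿ (¬p ∘ from)

  all-reflects : ∀ {X : Set} {P : X → Set} {p : X → Bool} →
    (∀ x → Reflects (P x) (p x)) → ∀ xs → Reflects (All P xs) (all p xs)
  all-reflects r []       = ofʸ []
  all-reflects r (x ∷ xs) = reflects-⇔ (λ (px , pxs) → px ∷ pxs) (λ { (px ∷ pxs) → px , pxs })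
    (r x ×-reflects all-reflects r xs)

  all-upTo-reflects : ∀ {P : ℕ → Set} {p : ℕ → Bool} →
    (∀ i → Reflects (P i) (p i)) → ∀ K → Reflects (∀ {i} → i < K → P i) (all p (upTo K))
  all-upTo-reflects r K = reflects-⇔ (λ ps i<K → All.lookup ps (∈-upTo⁺ i<K)) (λ ps → All.tabulate (ps ∘ ∈-upTo⁻))
    (all-reflects r (upTo K))

  indicator : Bool → ℕ
  indicator b = if b then 1 else 0

  countᵇ-++ : ∀ {X : Set} (p : X → Bool) xs ys → countᵇ p (xs ++ ys) ≡ countᵇ p xs + countᵇ p ys
  countᵇ-++ p []       ys = refl
  countᵇ-++ p (x ∷ xs) ys = trans (cong (indicator (p x) +_) (countᵇ-++ p xs ys)) (sym (+-assoc (indicator (p x)) _ _))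

  countᵇ-map : ∀ {X Y : Set} (p : Y → Bool) (f : X → Y) xs → countᵇ p (map f xs) ≡ countᵇ (p ∘ f) xs
  countᵇ-map p f []       = refl
  countᵇ-map p f (x ∷ xs) = cong (indicator (p (f x)) +_) (countᵇ-map p f xs)

  countᵇ-concatMap : ∀ {X Y : Set} (p : Y → Bool) (f : X → List Y) xs →
    countᵇ p (concatMap f xs) ≡ sum (map (countᵇ p ∘ f) xs)
  countᵇ-concatMap p f []       = refl
  countᵇ-concatMap p f (x ∷ xs) =
    trans (countᵇ-++ p (f x) (concatMap f xs)) (cong (countᵇ p (f x) +_) (countᵇ-concatMap p f xs))

  countᵇ-cong-∈ : ∀ {X : Set} {p q : X → Bool} xs → (∀ {x} → x ∈ xs → p x ≡ q x) → countᵇ p xs ≡ countᵇ q xs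
  countᵇ-cong-∈ []       eq = refl
  countᵇ-cong-∈ (x ∷ xs) eq = cong₂ _+_ (cong indicator (eq (here refl))) (countᵇ-cong-∈ xs (eq ∘ there))

  countᵇ-false : ∀ {X : Set} {p : X → Bool} xs → (∀ {x} → x ∈ xs → p x ≡ false) → countᵇ p xs ≡ 0
  countᵇ-false []       _  = refl
  countᵇ-false (x ∷ xs) px = cong₂ _+_ (cong indicator (px (here refl))) (countᵇ-false xs (px ∘ there))

  countᵇ-↭ : ∀ {X : Set} (p : X → Bool) {xs ys} → xs ↭ ys → countᵇ p xs ≡ countᵇ p ys
  countᵇ-↭ p ↭.refl = refl
  countᵇ-↭ p (↭.prep x xs↭ys) = cong (indicator (p x) +_) (countᵇ-↭ p xs↭ys)
  countᵇ-↭ p (↭.swap {xs} x y xs↭ys) = trans (x∙yz≈y∙xz (indicator (p x)) (indicator (p y)) (countᵇ p xs))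
    (cong (λ c → indicator (p y) + (indicator (p x) + c)) (countᵇ-↭ p xs↭ys))
  countᵇ-↭ p (↭.trans xs↭ys ys↭zs) = trans (countᵇ-↭ p xs↭ys) (countᵇ-↭ p ys↭zs)

  countᵇ-if : ∀ {X : Set} (g : X → Bool) (p q : Bool) xs →
    countᵇ (λ x → if g x then p else q) xs ≡ indicator p * countᵇ g xs + indicator q * countᵇ (not ∘ g) xs
  countᵇ-if g p q []       = sym (cong₂ _+_ (*-zeroʳ (indicator p)) (*-zeroʳ (indicator q)))
  countᵇ-if g p q (x ∷ xs) with g x
  ... | true  = trans (cong (indicator p +_) (countᵇ-if g p q xs))
    (solve 4 (λ a b c d → a :+ (a :* c :+ b :* d) := a :* (con 1 :+ c) :+ b :* d) refl
      (indicator p) (indicator q) (countᵇ g xs) (countᵇ (not ∘ g) xs))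
  ... | false = trans (cong (indicator q +_) (countᵇ-if g p q xs))
    (solve 4 (λ a b c d → b :+ (a :* c :+ b :* d) := a :* c :+ b :* (con 1 :+ d)) refl
      (indicator p) (indicator q) (countᵇ g xs) (countᵇ (not ∘ g) xs))

  countᵇ+countᵇ-not : ∀ {X : Set} (g : X → Bool) xs → countᵇ g xs + countᵇ (not ∘ g) xs ≡ length xs
  countᵇ+countᵇ-not g []       = refl
  countᵇ+countᵇ-not g (x ∷ xs) with g x
  ... | true  = cong suc (countᵇ+countᵇ-not g xs)
  ... | false = trans (+-suc _ _) (cong suc (countᵇ+countᵇ-not g xs))

  countᵇ-≤ : ∀ {X : Set} (p : X → Bool) xs → countᵇ p xs ≤ length xs
  countᵇ-≤ p xs = ≤-trans (m≤m+n (countᵇ p xs) _) (≤-reflexive (countᵇ+countᵇ-not p xs))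

  sum-map-cong-∈ : ∀ {X : Set} {f g : X → ℕ} xs → (∀ {x} → x ∈ xs → f x ≡ g x) → sum (map f xs) ≡ sum (map g xs)
  sum-map-cong-∈ xs eq = cong sum (map-cong-local (All.tabulate eq))

  sum-map-+ : ∀ {X : Set} (f g : X → ℕ) xs → sum (map (λ x → f x + g x) xs) ≡ sum (map f xs) + sum (map g xs)
  sum-map-+ f g []       = refl
  sum-map-+ f g (x ∷ xs) = trans (cong (f x + g x +_) (sum-map-+ f g xs)) (interchange (f x) (g x) _ _)

  sum-map-indicator : ∀ {X : Set} (p : X → Bool) c xs → sum (map (λ x → c * indicator (p x)) xs) ≡ c * countᵇ p xs
  sum-map-indicator p c []       = sym (*-zeroʳ c)
  sum-map-indicator p c (x ∷ xs) = trans (cong (c * indicator (p x) +_) (sum-map-indicator p c xs))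
    (sym (*-distribˡ-+ c (indicator (p x)) (countᵇ p xs)))

  at-++ˡ : ∀ xs ys {i} → i < length xs → at (xs ++ ys) i ≡ at xs i
  at-++ˡ (x ∷ xs) ys {zero}  _         = refl
  at-++ˡ (x ∷ xs) ys {suc i} (s≤s i<n) = at-++ˡ xs ys i<n

  at-++ʳ : ∀ xs ys i → at (xs ++ ys) (length xs + i) ≡ at ys i
  at-++ʳ []       ys i = refl
  at-++ʳ (x ∷ xs) ys i = at-++ʳ xs ys i

  at-replicate : ∀ c a {i} → i < c → at (replicate c a) i ≡ a
  at-replicate (suc c) a {zero}  _         = refl
  at-replicate (suc c) a {suc i} (s≤s i<c) = at-replicate c a i<c

  All-at : ∀ {P : ℕ → Set} {xs} → All P xs → ∀ {i} → i < length xs → P (at xs i)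
  All-at (px ∷ _)   {zero}  _         = px
  All-at (_ ∷ pxs) {suc i} (s≤s i<n) = All-at pxs i<n

  All-from-at : ∀ {P : ℕ → Set} xs → (∀ {t} → t < length xs → P (at xs t)) → All P xs
  All-from-at []       _  = []
  All-from-at (x ∷ xs) pt = pt (s≤s z≤n) ∷ All-from-at xs (pt ∘ s≤s)

  at-snoc : ∀ ks (k : ℕ) → at (ks ∷ʳ k) (length ks) ≡ k
  at-snoc []       k = refl
  at-snoc (_ ∷ ks) k = at-snoc ks k

  length-snoc : ∀ (ks : List ℕ) k → length (ks ∷ʳ k) ≡ suc (length ks)
  length-snoc ks k = trans (length-++ ks) (+-comm (length ks) 1)

  sum-snoc : ∀ ks k → sum (ks ∷ʳ k) ≡ sum ks + k
  sum-snoc ks k = trans (sum-++ ks (k ∷ [])) (cong (sum ks +_) (+-identityʳ k))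

  take-length-++ : ∀ (xs ys : List ℕ) → take (length xs) (xs ++ ys) ≡ xs
  take-length-++ []       ys = refl
  take-length-++ (x ∷ xs) ys = cong (x ∷_) (take-length-++ xs ys)

  drop-length-++ : ∀ (xs ys : List ℕ) → drop (length xs) (xs ++ ys) ≡ ys
  drop-length-++ []       ys = refl
  drop-length-++ (x ∷ xs) ys = drop-length-++ xs ys

  replicate-++-∷ : ∀ n (a : ℕ) l → replicate n a ++ a ∷ l ≡ replicate (suc n) a ++ l
  replicate-++-∷ zero    a l = refl
  replicate-++-∷ (suc n) a l = cong (a ∷_) (replicate-++-∷ n a l)

  ≤-≥⇒replicate : ∀ {a} vs → All (_≤ a) vs → All (a ≤_) vs → vs ≡ replicate (length vs) a
  ≤-≥⇒replicate []       []           []           = refl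
  ≤-≥⇒replicate (v ∷ vs) (v≤a ∷ vs≤a) (a≤v ∷ a≤vs) =
    cong₂ _∷_ (≤-antisym v≤a a≤v) (≤-≥⇒replicate vs vs≤a a≤vs)

  split-first : ∀ a {w} → a ∈ w → ∃₂ λ xs r → w ≡ xs ++ a ∷ r × All (a ≢_) xs
  split-first a {x ∷ w} a∈ with a ≟ x
  ... | yes refl = [] , w , refl , []
  split-first a {x ∷ w} (here a≡x) | no a≢x = contradiction a≡x a≢x
  split-first a {x ∷ w} (there a∈) | no a≢x =
    let xs , r , eq , a∉xs = split-first a a∈ in x ∷ xs , r , cong (x ∷_) eq , a≢x ∷ a∉xs

  split-last : ∀ a {w} → a ∈ w → ∃₂ λ vs ws → w ≡ vs ++ a ∷ ws × All (a ≢_) ws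
  split-last a {x ∷ w} a∈ with a ∈? w
  ... | yes a∈w = let vs , ws , eq , a∉ws = split-last a a∈w in x ∷ vs , ws , cong (x ∷_) eq , a∉ws
  ... | no a∉w with a∈
  ...   | here refl = [] , w , refl , ¬Any⇒All¬ w a∉w
  ...   | there a∈w = contradiction a∈w a∉w

  indexOf : ℕ → List ℕ → ℕ
  indexOf a []      = 0
  indexOf a (x ∷ w) = if a == x then 0 else suc (indexOf a w)

  indexOf-++ : ∀ a xs r → All (a ≢_) xs → indexOf a (xs ++ a ∷ r) ≡ length xs
  indexOf-++ a []       r []           rewrite ==-refl a = refl
  indexOf-++ a (x ∷ xs) r (a≢x ∷ a∉xs) rewrite ≢⇒==-false a≢x = cong suc (indexOf-++ a xs r a∉xs)

  occ-++ : ∀ a xs ys → occ a (xs ++ ys) ≡ occ a xs + occ a ys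
  occ-++ a []       ys = refl
  occ-++ a (x ∷ xs) ys = trans (cong ((if a == x then 1 else 0) +_) (occ-++ a xs ys)) (sym (+-assoc _ (occ a xs) (occ a ys)))

  occ-replicate : ∀ a c b → occ a (replicate c b) ≡ (if a == b then c else 0)
  occ-replicate a zero    b with a == b
  ... | true  = refl
  ... | false = refl
  occ-replicate a (suc c) b rewrite occ-replicate a c b with a == b
  ... | true  = refl
  ... | false = refl

  occ-∉ : ∀ a {xs} → All (a ≢_) xs → occ a xs ≡ 0
  occ-∉ a []           = refl
  occ-∉ a (a≢x ∷ a∉xs) rewrite ≢⇒==-false a≢x = occ-∉ a a∉xs

  occ-pos⇒∈ : ∀ a xs → 0 < occ a xs → a ∈ xs
  occ-pos⇒∈ a (x ∷ xs) pos with a == x | ==-reflects-≡ a x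
  ... | true  | ofʸ refl = here refl
  ... | false | ofⁿ _    = there (occ-pos⇒∈ a xs pos)

  occ-block : ∀ a c N xs ys → occ a (xs ++ replicate c N ++ ys) ≡ occ a (xs ++ ys) + (if a == N then c else 0)
  occ-block a c N xs ys = begin
    occ a (xs ++ replicate c N ++ ys)               ≡⟨ occ-++ a xs _ ⟩
    occ a xs + occ a (replicate c N ++ ys)          ≡⟨ cong (occ a xs +_) (occ-++ a (replicate c N) ys) ⟩
    occ a xs + (occ a (replicate c N) + occ a ys)   ≡⟨ cong (λ o → occ a xs + (o + occ a ys)) (occ-replicate a c N) ⟩
    occ a xs + ((if a == N then c else 0) + occ a ys) ≡⟨ cong (occ a xs +_) (+-comm _ (occ a ys)) ⟩
    occ a xs + (occ a ys + (if a == N then c else 0)) ≡⟨ sym (+-assoc (occ a xs) _ _) ⟩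
    occ a xs + occ a ys + (if a == N then c else 0)   ≡⟨ cong (_+ _) (sym (occ-++ a xs ys)) ⟩
    occ a (xs ++ ys) + (if a == N then c else 0)      ∎
    where open ≡.≡-Reasoning

  occ-block-other : ∀ {a} c N xs ys → a ≢ N → occ a (xs ++ replicate c N ++ ys) ≡ occ a (xs ++ ys)
  occ-block-other {a} c N xs ys a≢N = trans (occ-block a c N xs ys)
    (trans (cong (λ b → occ a (xs ++ ys) + (if b then c else 0)) (≢⇒==-false a≢N)) (+-identityʳ _))

  occ-block-self : ∀ c N xs ys → All (N ≢_) (xs ++ ys) → occ N (xs ++ replicate c N ++ ys) ≡ c
  occ-block-self c N xs ys N∉ = trans (occ-block N c N xs ys)
    (cong₂ (λ o b → o + (if b then c else 0)) (occ-∉ N N∉) (==-refl N))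

  length-block : ∀ c (N : ℕ) xs ys → length (xs ++ replicate c N ++ ys) ≡ length (xs ++ ys) + c
  length-block c N xs ys = begin
    length (xs ++ replicate c N ++ ys)        ≡⟨ length-++ xs ⟩
    length xs + length (replicate c N ++ ys)  ≡⟨ cong (length xs +_) (length-++ (replicate c N)) ⟩
    length xs + (length (replicate c N) + length ys)
                                              ≡⟨ cong (λ l → length xs + (l + length ys)) (length-replicate c) ⟩
    length xs + (c + length ys)               ≡⟨ cong (length xs +_) (+-comm c _) ⟩
    length xs + (length ys + c)               ≡⟨ sym (+-assoc (length xs) _ c) ⟩
    length xs + length ys + c                 ≡⟨ cong (_+ c) (sym (length-++ xs)) ⟩
    length (xs ++ ys) + c                     ∎
    where open ≡.≡-Reasoning

  unique-concatMap-map : ∀ {X Y Z : Set} (g : X → Y → Z) (h : Z → X × Y) xs ys → Unique xs → Unique ys →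
    (∀ {x y} → x ∈ xs → y ∈ ys → h (g x y) ≡ (x , y)) → Unique (concatMap (λ x → map (g x) ys) xs)
  unique-concatMap-map g h xs ys xs! ys! hg =
    Unique.map⁻ (subst Unique (sym (h∘g xs (λ x∈ → x∈))) (Unique.cartesianProductWith⁺ _,_ ,-injective xs! ys!))
    where
    ,-injective : ∀ {x x′ y y′} → (x , y) ≡ (x′ , y′) → x ≡ x′ × y ≡ y′
    ,-injective refl = refl , refl
    h∘g : ∀ xs′ → (∀ {x} → x ∈ xs′ → x ∈ xs) →
      map h (concatMap (λ x → map (g x) ys) xs′) ≡ cartesianProductWith _,_ xs′ ys
    h∘g []        _   = refl
    h∘g (x ∷ xs′) sub = trans (map-++ h (map (g x) ys) _) (cong₂ _++_
      (trans (sym (map-∘ ys)) (map-cong-local (All.tabulate (hg (sub (here refl))))))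
      (h∘g xs′ (sub ∘ there)))

  -- Words and Stirling permutations

  Letters : ℕ → List ℕ → Set
  Letters n = All (λ a → 1 ≤ a × a ≤ n)

  HasMultiset : List ℕ → List ℕ → Set
  HasMultiset k w = ∀ {i} → i < length k → occ (suc i) w ≡ at k i

  IsStirling : List ℕ → Set
  IsStirling w = ∀ {i s j} → i < s → s < j → j < length w → at w i ≡ at w j → at w i ≤ at w s

  hasMultiset-reflects : ∀ k w → Reflects (HasMultiset k w) (hasMultiset k w)
  hasMultiset-reflects k w = all-upTo-reflects (λ i → ==-reflects-≡ (occ (suc i) w) (at k i)) (length k)

  stirlingCond-reflects : ∀ w → Reflects (IsStirling w) (stirlingCond w)
  stirlingCond-reflects w = reflects-⇔
    (λ st {i} {s} {j} i<s s<j j<K eq → let s<K = <-trans s<j j<K in st (<-trans i<s s<K) j<K s<K (i<s , s<j , eq))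
    (λ st {_} _ {_} j<K {_} _ (i<s , s<j , eq) → st i<s s<j j<K eq)
    (all-upTo-reflects (λ i → all-upTo-reflects (λ j → all-upTo-reflects (λ s →
        (<ᵇ-reflects-< i s ×-reflects (<ᵇ-reflects-< s j ×-reflects ==-reflects-≡ (at w i) (at w j)))
          →-reflects ≤ᵇ-reflects-≤ (at w i) (at w s)) K) K) K)
    where K = length w

  isSP-reflects : ∀ k w → Reflects (HasMultiset k w × IsStirling w) (isSP k w)
  isSP-reflects k w = hasMultiset-reflects k w ×-reflects stirlingCond-reflects w

  ∈-words⁺ : ∀ n {w} → Letters n w → w ∈ words n (length w)
  ∈-words⁺ n []                           = here refl
  ∈-words⁺ n {suc a ∷ w} ((_ , a<n) ∷ lw) =
    ∈-concatMap⁺ (λ a → map (suc a ∷_) (words n (length w))) (lose (∈-upTo⁺ a<n) (∈-map⁺ (suc a ∷_) (∈-words⁺ n lw)))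

  ∈-words⁻ : ∀ n L {w} → w ∈ words n L → length w ≡ L × Letters n w
  ∈-words⁻ n zero    (here refl) = refl , []
  ∈-words⁻ n (suc L) w∈ with find (∈-concatMap⁻ (λ a → map (suc a ∷_) (words n L)) {xs = upTo n} w∈)
  ... | a , a∈ , w∈′ with ∈-map⁻ (suc a ∷_) w∈′
  ... | w′ , w′∈ , refl = let |w′| , lw′ = ∈-words⁻ n L w′∈ in cong suc |w′| , (s≤s z≤n , ∈-upTo⁻ a∈) ∷ lw′

  words-unique : ∀ n L → Unique (words n L)
  words-unique n zero    = [] ∷ []
  words-unique n (suc L) = subst Unique (sym (concatMap-map≡cartesianProductWith (upTo n)))
    (Unique.cartesianProductWith⁺ (λ a w → suc a ∷ w) ∷-injective (Unique.upTo⁺ n) (words-unique n L))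
    where
    ∷-injective : ∀ {a b : ℕ} {v w} → suc a ∷ v ≡ suc b ∷ w → a ≡ b × v ≡ w
    ∷-injective refl = refl , refl
    concatMap-map≡cartesianProductWith : ∀ as →
      concatMap (λ a → map (suc a ∷_) (words n L)) as ≡ cartesianProductWith (λ a w → suc a ∷ w) as (words n L)
    concatMap-map≡cartesianProductWith []       = refl
    concatMap-map≡cartesianProductWith (a ∷ as) = cong (map (suc a ∷_) (words n L) ++_) (concatMap-map≡cartesianProductWith as)

  SP≡filter : ∀ k → SP k ≡ filter (T? ∘ isSP k) (words (length k) (sum k))
  SP≡filter k = go (words (length k) (sum k))
    where
    go : ∀ ws → foldr (λ w r → if isSP k w then w ∷ r else r) [] ws ≡ filter (T? ∘ isSP k) ws
    go []       = refl
    go (w ∷ ws) with isSP k w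
    ... | true  = cong (w ∷_) (go ws)
    ... | false = go ws

  SP-unique : ∀ k → Unique (SP k)
  SP-unique k rewrite SP≡filter k = Unique.filter⁺ (T? ∘ isSP k) (words-unique (length k) (sum k))

  ∈-SP⁺ : ∀ k {w} → length w ≡ sum k → Letters (length k) w → HasMultiset k w → IsStirling w → w ∈ SP k
  ∈-SP⁺ k {w} |w| lw mult st rewrite SP≡filter k =
    ∈-filter⁺ (T? ∘ isSP k) (subst (λ L → w ∈ words (length k) L) |w| (∈-words⁺ (length k) lw))
      (reflects-toT (isSP-reflects k w) (mult , st))

  ∈-SP⁻ : ∀ k {w} → w ∈ SP k → length w ≡ sum k × Letters (length k) w × HasMultiset k w × IsStirling w
  ∈-SP⁻ k {w} w∈ rewrite SP≡filter k with ∈-filter⁻ (T? ∘ isSP k) w∈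
  ... | w∈words , t with ∈-words⁻ (length k) (sum k) w∈words
  ... | |w| , lw = |w| , lw , reflects-fromT (isSP-reflects k w) t

  -- Inserting a block of the new largest letter

  module BlockSplit (xs ys : List ℕ) (c N : ℕ) where

    p : ℕ
    p = length xs
    w σ : List ℕ
    w = xs ++ replicate c N ++ ys
    σ = xs ++ ys

    length-w : length w ≡ p + (c + length ys)
    length-w = trans (length-++ xs) (cong (p +_) (trans (length-++ (replicate c N)) (cong (_+ length ys) (length-replicate c))))

    length-σ : length σ ≡ p + length ys
    length-σ = length-++ xs

    at-after-block : ∀ r → at w (p + (c + r)) ≡ at ys r
    at-after-block r = trans (at-++ʳ xs _ (c + r))
      (subst (λ c′ → at (replicate c N ++ ys) (c′ + r) ≡ at ys r) (length-replicate c) (at-++ʳ (replicate c N) ys r))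

    at-block : ∀ {u} → p ≤ u → u < p + c → at w u ≡ N
    at-block {u} p≤u u<p+c = begin
      at w u                                ≡⟨ cong (at w) (sym (m+[n∸m]≡n p≤u)) ⟩
      at w (p + (u ∸ p))                    ≡⟨ at-++ʳ xs _ (u ∸ p) ⟩
      at (replicate c N ++ ys) (u ∸ p)      ≡⟨ at-++ˡ (replicate c N) ys (subst (u ∸ p <_) (sym (length-replicate c)) u∸p<c) ⟩
      at (replicate c N) (u ∸ p)            ≡⟨ at-replicate c N u∸p<c ⟩
      N                                     ∎
      where
      open ≡.≡-Reasoning
      u∸p<c : u ∸ p < c
      u∸p<c = +-cancelˡ-< p (u ∸ p) c (subst (_< p + c) (sym (m+[n∸m]≡n p≤u)) u<p+c)

    -- Position u of w carries the t-th letter of σ.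
    Lifts : ℕ → ℕ → Set
    Lifts u t = (u < p × u ≡ t) ⊎ (p ≤ t × u ≡ t + c)

    lifts-mono : ∀ {u₁ t₁ u₂ t₂} → Lifts u₁ t₁ → Lifts u₂ t₂ → u₁ < u₂ → t₁ < t₂
    lifts-mono (inj₁ (_ , refl))     (inj₁ (_ , refl))     lt = lt
    lifts-mono (inj₁ (u₁<p , refl))  (inj₂ (p≤t₂ , _))     lt = <-≤-trans u₁<p p≤t₂
    lifts-mono {t₁ = t₁} (inj₂ (p≤t₁ , refl)) (inj₁ (u₂<p , refl)) lt =
      contradiction (<-≤-trans (<-trans lt u₂<p) (≤-trans p≤t₁ (m≤m+n t₁ c))) (<-irrefl refl)
    lifts-mono {t₁ = t₁} {t₂ = t₂} (inj₂ (_ , refl)) (inj₂ (_ , refl)) lt = +-cancelʳ-< c t₁ t₂ lt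

    lifts-mono⁻ : ∀ {u₁ t₁ u₂ t₂} → Lifts u₁ t₁ → Lifts u₂ t₂ → t₁ < t₂ → u₁ < u₂
    lifts-mono⁻ (inj₁ (_ , refl))    (inj₁ (_ , refl))    lt = lt
    lifts-mono⁻ {t₂ = t₂} (inj₁ (u₁<p , refl)) (inj₂ (p≤t₂ , refl)) lt = <-≤-trans u₁<p (≤-trans p≤t₂ (m≤m+n t₂ c))
    lifts-mono⁻ (inj₂ (p≤t₁ , refl)) (inj₁ (u₂<p , refl)) lt = contradiction (<-≤-trans (<-trans lt u₂<p) p≤t₁) (<-irrefl refl)
    lifts-mono⁻ (inj₂ (_ , refl))    (inj₂ (_ , refl))    lt = +-monoˡ-< c lt

    lift : ∀ {t} → t < length σ → ∃ λ u → u < length w × at w u ≡ at σ t × Lifts u t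
    lift {t} t<σ with t <? p
    ... | yes t<p = t , <-≤-trans t<p (subst (p ≤_) (sym length-w) (m≤m+n p _)) ,
                    trans (at-++ˡ xs _ t<p) (sym (at-++ˡ xs ys t<p)) , inj₁ (t<p , refl)
    ... | no t≮p = p + (c + r) , u<w , at-eq , inj₂ (p≤t , u≡)
      where
      p≤t : p ≤ t
      p≤t = ≮⇒≥ t≮p
      r : ℕ
      r = t ∸ p
      t≡ : t ≡ p + r
      t≡ = sym (m+[n∸m]≡n p≤t)
      u<w : p + (c + r) < length w
      u<w = subst (p + (c + r) <_) (sym length-w)
        (+-monoʳ-< p (+-monoʳ-< c (+-cancelˡ-< p r (length ys) (subst₂ _<_ t≡ length-σ t<σ))))
      u≡ : p + (c + r) ≡ t + c
      u≡ = trans (cong (p +_) (+-comm c r)) (trans (sym (+-assoc p r c)) (cong (_+ c) (sym t≡)))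
      at-eq : at w (p + (c + r)) ≡ at σ t
      at-eq = trans (at-after-block r) (sym (trans (cong (at σ) t≡) (at-++ʳ xs ys r)))

    lift-or-block : ∀ {u} → u < length w → (∃ λ t → t < length σ × at w u ≡ at σ t × Lifts u t) ⊎ (p ≤ u × u < p + c)
    lift-or-block {u} u<w with u <? p
    ... | yes u<p = inj₁ (u , <-≤-trans u<p (subst (p ≤_) (sym length-σ) (m≤m+n p _)) ,
                          trans (at-++ˡ xs _ u<p) (sym (at-++ˡ xs ys u<p)) , inj₁ (u<p , refl))
    ... | no u≮p with u ∸ p <? c
    ... | yes u∸p<c = inj₂ (≮⇒≥ u≮p , subst (_< p + c) (m+[n∸m]≡n (≮⇒≥ u≮p)) (+-monoʳ-< p u∸p<c))
    ... | no u∸p≮c = inj₁ (p + r , t<σ , at-eq , inj₂ (m≤m+n p r , u≡))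
      where
      r : ℕ
      r = u ∸ p ∸ c
      u≡′ : u ≡ p + (c + r)
      u≡′ = trans (sym (m+[n∸m]≡n (≮⇒≥ u≮p))) (cong (p +_) (sym (m+[n∸m]≡n (≮⇒≥ u∸p≮c))))
      u≡ : u ≡ p + r + c
      u≡ = trans u≡′ (trans (cong (p +_) (+-comm c r)) (sym (+-assoc p r c)))
      t<σ : p + r < length σ
      t<σ = subst (p + r <_) (sym length-σ) (+-monoʳ-< p (+-cancelˡ-< c r (length ys)
              (+-cancelˡ-< p (c + r) (c + length ys) (subst₂ _<_ u≡′ length-w u<w))))
      at-eq : at w u ≡ at σ (p + r)
      at-eq = trans (cong (at w) u≡′) (trans (at-after-block r) (sym (at-++ʳ xs ys r)))

    IsStirling-insert : (∀ {t} → t < length σ → at σ t < N) → IsStirling σ → IsStirling w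
    IsStirling-insert σ<N st {i} {s} {j} i<s s<j j<w eq
      with lift-or-block (<-trans i<s (<-trans s<j j<w)) | lift-or-block j<w
    ... | inj₁ (tᵢ , tᵢ< , eqᵢ , _) | inj₂ (p≤j , j<) =
          contradiction (subst (_< N) (trans (sym eqᵢ) (trans eq (at-block p≤j j<))) (σ<N tᵢ<)) (<-irrefl refl)
    ... | inj₂ (p≤i , i<) | inj₁ (tⱼ , tⱼ< , eqⱼ , _) =
          contradiction (subst (_< N) (trans (sym eqⱼ) (trans (sym eq) (at-block p≤i i<))) (σ<N tⱼ<)) (<-irrefl refl)
    ... | inj₂ (p≤i , i<) | inj₂ (p≤j , j<) =
          ≤-reflexive (trans (at-block p≤i i<) (sym (at-block (≤-trans p≤i (<⇒≤ i<s)) (<-trans s<j j<))))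
    ... | inj₁ (tᵢ , tᵢ< , eqᵢ , liftᵢ) | inj₁ (tⱼ , tⱼ< , eqⱼ , liftⱼ) with lift-or-block (<-trans s<j j<w)
    ...   | inj₂ (p≤s , s<) = subst (at w i ≤_) (sym (at-block p≤s s<)) (<⇒≤ (subst (_< N) (sym eqᵢ) (σ<N tᵢ<)))
    ...   | inj₁ (tₛ , _ , eqₛ , liftₛ) = subst₂ _≤_ (sym eqᵢ) (sym eqₛ)
            (st (lifts-mono liftᵢ liftₛ i<s) (lifts-mono liftₛ liftⱼ s<j) tⱼ< (trans (sym eqᵢ) (trans eq eqⱼ)))

    IsStirling-remove : IsStirling w → IsStirling σ
    IsStirling-remove st tᵢ<tₛ tₛ<tⱼ tⱼ< eq
      with lift (<-trans tᵢ<tₛ (<-trans tₛ<tⱼ tⱼ<)) | lift (<-trans tₛ<tⱼ tⱼ<) | lift tⱼ<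
    ... | _ , _ , eqᵢ , liftᵢ | _ , _ , eqₛ , liftₛ | _ , uⱼ< , eqⱼ , liftⱼ = subst₂ _≤_ eqᵢ eqₛ
          (st (lifts-mono⁻ liftᵢ liftₛ tᵢ<tₛ) (lifts-mono⁻ liftₛ liftⱼ tₛ<tⱼ) uⱼ< (trans eqᵢ (trans eq (sym eqⱼ))))

  IsStirling-between : ∀ us a vs ws → IsStirling (us ++ a ∷ vs ++ a ∷ ws) → All (a ≤_) vs
  IsStirling-between us a vs ws st = All-from-at vs λ {t} t<vs →
    subst₂ _≤_ at-i (at-s t<vs)
      (st (+-monoʳ-< |us| (s≤s z≤n)) (+-monoʳ-< |us| (s≤s (<-≤-trans t<vs (m≤m+n |vs| 0)))) j<w (trans at-i (sym at-j)))
    where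
    |us| |vs| : ℕ
    |us| = length us
    |vs| = length vs
    w : List ℕ
    w = us ++ a ∷ vs ++ a ∷ ws
    at-i : at w (|us| + 0) ≡ a
    at-i = at-++ʳ us _ 0
    at-s : ∀ {t} → t < |vs| → at w (|us| + suc t) ≡ at vs t
    at-s {t} t<vs = trans (at-++ʳ us _ (suc t)) (at-++ˡ vs (a ∷ ws) t<vs)
    at-j : at w (|us| + suc (|vs| + 0)) ≡ a
    at-j = trans (at-++ʳ us _ (suc (|vs| + 0))) (at-++ʳ vs (a ∷ ws) 0)
    j<w : |us| + suc (|vs| + 0) < length w
    j<w = subst (|us| + suc (|vs| + 0) <_) (sym (trans (length-++ us) (cong (λ l → |us| + suc l) (length-++ vs))))
      (+-monoʳ-< |us| (s≤s (+-monoʳ-< |vs| (s≤s z≤n))))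

  largest-block : ∀ N {w} → All (_≤ N) w → IsStirling w → N ∈ w →
    ∃₂ λ xs ys → ∃ λ c → w ≡ xs ++ replicate (suc c) N ++ ys × All (N ≢_) xs × All (N ≢_) ys
  largest-block N {w} w≤N st N∈w with split-first N N∈w
  ... | xs , r , refl , N∉xs with N ∈? r
  ...   | no N∉r = xs , r , 0 , refl , N∉xs , ¬Any⇒All¬ r N∉r
  ...   | yes N∈r with split-last N N∈r
  ...     | vs , ys , refl , N∉ys with Allₚ.++⁻ xs w≤N
  ...       | _ , _ ∷ r≤N = xs , ys , suc (length vs) , w≡ , N∉xs , N∉ys
    where
    vs≡ : vs ≡ replicate (length vs) N
    vs≡ = ≤-≥⇒replicate vs (proj₁ (Allₚ.++⁻ vs r≤N)) (IsStirling-between xs N vs ys st)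
    w≡ : xs ++ N ∷ vs ++ N ∷ ys ≡ xs ++ replicate (suc (suc (length vs))) N ++ ys
    w≡ = cong (λ l → xs ++ N ∷ l) (trans (cong (_++ N ∷ ys) vs≡) (replicate-++-∷ (length vs) N ys))

  newLetter : List ℕ → ℕ
  newLetter ks = suc (length ks)

  module _ (ks : List ℕ) where

    private
      N : ℕ
      N = newLetter ks

    HasMultiset-block : ∀ c xs ys → HasMultiset ks (xs ++ ys) → HasMultiset ks (xs ++ replicate c N ++ ys)
    HasMultiset-block c xs ys mult i<n = trans (occ-block-other c N xs ys (<⇒≢ (s≤s i<n))) (mult i<n)

    HasMultiset-unblock : ∀ c xs ys → HasMultiset ks (xs ++ replicate c N ++ ys) → HasMultiset ks (xs ++ ys)
    HasMultiset-unblock c xs ys mult i<n = trans (sym (occ-block-other c N xs ys (<⇒≢ (s≤s i<n)))) (mult i<n)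

    HasMultiset-snoc⁺ : ∀ {kn} w → HasMultiset ks w → occ N w ≡ kn → HasMultiset (ks ∷ʳ kn) w
    HasMultiset-snoc⁺ {kn} w mult occN {i} i<n+1 with <-cmp i (length ks)
    ... | tri< i<n _ _ = trans (mult i<n) (sym (at-++ˡ ks (kn ∷ []) i<n))
    ... | tri≈ _ refl _ = trans occN (sym (at-snoc ks kn))
    ... | tri> _ _ i>n = contradiction (subst (i <_) (length-snoc ks kn) i<n+1) (<⇒≱ (s≤s i>n))

    HasMultiset-snoc⁻ : ∀ {kn} w → HasMultiset (ks ∷ʳ kn) w → HasMultiset ks w × occ N w ≡ kn
    HasMultiset-snoc⁻ {kn} w mult =
        (λ i<n → trans (mult (subst (_ <_) (sym (length-snoc ks kn)) (m<n⇒m<1+n i<n))) (at-++ˡ ks (kn ∷ []) i<n))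
      , trans (mult (subst (length ks <_) (sym (length-snoc ks kn)) ≤-refl)) (at-snoc ks kn)

  Letters-block : ∀ {n} c xs ys → Letters n (xs ++ ys) → Letters (suc n) (xs ++ replicate c (suc n) ++ ys)
  Letters-block {n} c xs ys ls with Allₚ.++⁻ xs ls
  ... | lxs , lys = Allₚ.++⁺ (All.map weaken lxs) (Allₚ.++⁺ (Allₚ.replicate⁺ c (s≤s z≤n , ≤-refl)) (All.map weaken lys))
    where
    weaken : ∀ {a} → 1 ≤ a × a ≤ n → 1 ≤ a × a ≤ suc n
    weaken (1≤a , a≤n) = 1≤a , m≤n⇒m≤1+n a≤n

  Letters-unblock : ∀ {n} c xs ys → Letters (suc n) (xs ++ replicate c (suc n) ++ ys) →
    All (suc n ≢_) xs → All (suc n ≢_) ys → Letters n (xs ++ ys)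
  Letters-unblock c xs ys ls N∉xs N∉ys with Allₚ.++⁻ xs ls
  ... | lxs , lbys = Allₚ.++⁺ (lower lxs N∉xs) (lower (proj₂ (Allₚ.++⁻ (replicate c _) lbys)) N∉ys)
    where
    lower : ∀ {n vs} → Letters (suc n) vs → All (suc n ≢_) vs → Letters n vs
    lower []                  []           = []
    lower ((1≤a , a≤n+1) ∷ l) (N≢a ∷ N∉vs) = (1≤a , ≤-pred (≤∧≢⇒< a≤n+1 (N≢a ∘ sym))) ∷ lower l N∉vs

  Letters⇒∉ : ∀ {n vs} → Letters n vs → All (suc n ≢_) vs
  Letters⇒∉ = All.map (λ (_ , a≤n) N≡a → <⇒≱ (s≤s a≤n) (≤-reflexive N≡a))

  block-∈-SP⁺ : ∀ ks kn xs ys → xs ++ ys ∈ SP ks → xs ++ replicate kn (newLetter ks) ++ ys ∈ SP (ks ∷ʳ kn)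
  block-∈-SP⁺ ks kn xs ys σ∈ with ∈-SP⁻ ks σ∈
  ... | |σ| , lσ , mult , st = ∈-SP⁺ (ks ∷ʳ kn) |w| lw mult′ st′
    where
    N : ℕ
    N = newLetter ks
    |w| : length (xs ++ replicate kn N ++ ys) ≡ sum (ks ∷ʳ kn)
    |w| = trans (length-block kn N xs ys) (trans (cong (_+ kn) |σ|) (sym (sum-snoc ks kn)))
    lw : Letters (length (ks ∷ʳ kn)) (xs ++ replicate kn N ++ ys)
    lw = subst (λ n → Letters n (xs ++ replicate kn N ++ ys)) (sym (length-snoc ks kn)) (Letters-block kn xs ys lσ)
    occN : occ N (xs ++ replicate kn N ++ ys) ≡ kn
    occN = occ-block-self kn N xs ys (Letters⇒∉ lσ)
    mult′ : HasMultiset (ks ∷ʳ kn) (xs ++ replicate kn N ++ ys)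
    mult′ = HasMultiset-snoc⁺ ks (xs ++ replicate kn N ++ ys) (HasMultiset-block ks kn xs ys mult) occN
    st′ : IsStirling (xs ++ replicate kn N ++ ys)
    st′ = BlockSplit.IsStirling-insert xs ys kn N (λ t< → s≤s (proj₂ (All-at lσ t<))) st

  block-∈-SP⁻ : ∀ ks kn {w} → 1 ≤ kn → w ∈ SP (ks ∷ʳ kn) →
    ∃₂ λ xs ys → w ≡ xs ++ replicate kn (newLetter ks) ++ ys × xs ++ ys ∈ SP ks
  block-∈-SP⁻ ks kn {w} 1≤kn w∈ with ∈-SP⁻ (ks ∷ʳ kn) w∈
  ... | |w| , lw , mult , st with HasMultiset-snoc⁻ ks w mult
  ...   | mult′ , occN
    with largest-block (newLetter ks) (All.map proj₂ (subst (λ n → Letters n w) (length-snoc ks kn) lw)) st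
           (occ-pos⇒∈ _ w (subst (0 <_) (sym occN) 1≤kn))
  ...     | xs , ys , c , refl , N∉xs , N∉ys = xs , ys , cong (λ k → xs ++ replicate k N ++ ys) c+1≡kn , σ∈
    where
    N : ℕ
    N = newLetter ks
    lw′ : Letters N w
    lw′ = subst (λ n → Letters n w) (length-snoc ks kn) lw
    c+1≡kn : suc c ≡ kn
    c+1≡kn = trans (sym (occ-block-self (suc c) N xs ys (Allₚ.++⁺ N∉xs N∉ys))) occN
    |σ| : length (xs ++ ys) ≡ sum ks
    |σ| = +-cancelʳ-≡ kn _ _ (trans (cong (length (xs ++ ys) +_) (sym c+1≡kn))
            (trans (sym (length-block (suc c) N xs ys)) (trans |w| (sum-snoc ks kn))))
    σ∈ : xs ++ ys ∈ SP ks
    σ∈ = ∈-SP⁺ ks |σ| (Letters-unblock (suc c) xs ys lw′ N∉xs N∉ys) (HasMultiset-unblock ks (suc c) xs ys mult′)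
           (BlockSplit.IsStirling-remove xs ys (suc c) N st)

  insertBlock : ℕ → ℕ → ℕ → List ℕ → List ℕ
  insertBlock c N p σ = take p σ ++ replicate c N ++ drop p σ

  insertions : List ℕ → ℕ → List (List ℕ)
  insertions ks kn = concatMap (λ σ → map (λ p → insertBlock kn (newLetter ks) p σ) (upTo (suc (sum ks)))) (SP ks)

  removeBlock : ℕ → List ℕ → List ℕ × ℕ
  removeBlock N w = filter (λ x → ¬? (N ≟ x)) w , indexOf N w

  removeBlock-insertBlock : ∀ c N p σ → All (N ≢_) σ → p ≤ length σ → removeBlock N (insertBlock (suc c) N p σ) ≡ (σ , p)
  removeBlock-insertBlock c N p σ N∉σ p≤ = cong₂ _,_ filter-eq index-eq
    where
    keep : ∀ x → Dec (N ≢ x)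
    keep x = ¬? (N ≟ x)
    filter-eq : filter keep (insertBlock (suc c) N p σ) ≡ σ
    filter-eq = begin
      filter keep (take p σ ++ replicate (suc c) N ++ drop p σ)
        ≡⟨ filter-++ keep (take p σ) _ ⟩
      filter keep (take p σ) ++ filter keep (replicate (suc c) N ++ drop p σ)
        ≡⟨ cong (filter keep (take p σ) ++_) (filter-++ keep (replicate (suc c) N) _) ⟩
      filter keep (take p σ) ++ filter keep (replicate (suc c) N) ++ filter keep (drop p σ)
        ≡⟨ cong₂ _++_ (filter-all keep (Allₚ.take⁺ p N∉σ))
             (cong₂ _++_ (filter-none keep (Allₚ.replicate⁺ (suc c) λ N≢N → N≢N refl)) (filter-all keep (Allₚ.drop⁺ p N∉σ))) ⟩
      take p σ ++ drop p σ
        ≡⟨ take++drop≡id p σ ⟩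
      σ ∎
      where open ≡.≡-Reasoning
    index-eq : indexOf N (insertBlock (suc c) N p σ) ≡ p
    index-eq = trans (indexOf-++ N (take p σ) _ (Allₚ.take⁺ p N∉σ)) (trans (length-take p σ) (m≤n⇒m⊓n≡m p≤))

  insertions-unique : ∀ ks kn → 1 ≤ kn → Unique (insertions ks kn)
  insertions-unique ks (suc c) _ = unique-concatMap-map (λ σ p → insertBlock (suc c) _ p σ) (removeBlock (newLetter ks))
    (SP ks) (upTo (suc (sum ks))) (SP-unique ks) (Unique.upTo⁺ _)
    λ {σ} σ∈ p∈ → let |σ| , lσ , _ = ∈-SP⁻ ks σ∈ in
      removeBlock-insertBlock c _ _ σ (Letters⇒∉ lσ) (subst (_ ≤_) (sym |σ|) (≤-pred (∈-upTo⁻ p∈)))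

  ∈-insertions⁺ : ∀ ks kn {σ p} → σ ∈ SP ks → p ≤ sum ks → insertBlock kn (newLetter ks) p σ ∈ insertions ks kn
  ∈-insertions⁺ ks kn {σ} σ∈ p≤ = ∈-concatMap⁺ (λ σ → map (λ p → insertBlock kn _ p σ) (upTo (suc (sum ks))))
    (lose σ∈ (∈-map⁺ (λ p → insertBlock kn _ p σ) (∈-upTo⁺ (s≤s p≤))))

  ∈-insertions⁻ : ∀ ks kn {w} → w ∈ insertions ks kn →
    ∃₂ λ σ p → σ ∈ SP ks × p ≤ sum ks × w ≡ insertBlock kn (newLetter ks) p σ
  ∈-insertions⁻ ks kn w∈ with find (∈-concatMap⁻ (λ σ → map (λ p → insertBlock kn _ p σ) (upTo (suc (sum ks)))) {xs = SP ks} w∈)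
  ... | σ , σ∈ , w∈′ with ∈-map⁻ (λ p → insertBlock kn _ p σ) w∈′
  ...   | p , p∈ , w≡ = σ , p , σ∈ , ≤-pred (∈-upTo⁻ p∈) , w≡

  SP-snoc↭insertions : ∀ ks kn → 1 ≤ kn → SP (ks ∷ʳ kn) ↭ insertions ks kn
  SP-snoc↭insertions ks kn 1≤kn = ∼bag⇒↭ (unique∧set⇒bag (SP-unique (ks ∷ʳ kn)) (insertions-unique ks kn 1≤kn)
    (mk⇔ to from))
    where
    N : ℕ
    N = newLetter ks
    to : ∀ {w} → w ∈ SP (ks ∷ʳ kn) → w ∈ insertions ks kn
    to w∈ with block-∈-SP⁻ ks kn 1≤kn w∈
    ... | xs , ys , refl , σ∈ = subst (_∈ insertions ks kn)
      (cong₂ (λ us vs → us ++ replicate kn N ++ vs) (take-length-++ xs ys) (drop-length-++ xs ys))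
      (∈-insertions⁺ ks kn σ∈ (≤-trans (length-++-≤ˡ xs) (≤-reflexive (proj₁ (∈-SP⁻ ks σ∈)))))
    from : ∀ {w} → w ∈ insertions ks kn → w ∈ SP (ks ∷ʳ kn)
    from w∈ with ∈-insertions⁻ ks kn w∈
    ... | σ , p , σ∈ , _ , refl = block-∈-SP⁺ ks kn (take p σ) (drop p σ) (subst (_∈ SP ks) (sym (take++drop≡id p σ)) σ∈)

  -- Descents and the recursion for A

  -- Descents of x ∷ r other than the final position.
  innerDes : ℕ → List ℕ → ℕ
  innerDes x []      = 0
  innerDes x (y ∷ r) = indicator (y <ᵇ x) + innerDes y r

  lastOf : ℕ → List ℕ → ℕ
  lastOf x []      = x
  lastOf x (y ∷ r) = lastOf y r

  des-∷ : ∀ x r → des (x ∷ r) ≡ suc (innerDes x r)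
  des-∷ x []      = refl
  des-∷ x (y ∷ r) =
    trans (cong (indicator (y <ᵇ x) +_) (trans tail (des-∷ y r))) (+-suc (indicator (y <ᵇ x)) (innerDes y r))
    where
    isDes : List ℕ → ℕ → Bool
    isDes w p = (suc p == length w) ∨ (at w (suc p) <ᵇ at w p)
    tail : countᵇ (isDes (x ∷ y ∷ r)) (applyUpTo suc (suc (length r))) ≡ des (y ∷ r)
    tail = trans (cong (countᵇ (isDes (x ∷ y ∷ r))) (sym (map-upTo suc (suc (length r)))))
      (trans (countᵇ-map (isDes (x ∷ y ∷ r)) suc (upTo (suc (length r))))
        (countᵇ-cong-∈ (upTo (suc (length r))) λ {p} _ →
          cong (_∨ (at (y ∷ r) (suc p) <ᵇ at (y ∷ r) p)) (==-suc (suc p) (suc (length r)))))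

  innerDes-++ : ∀ x xs y ys → innerDes x (xs ++ y ∷ ys) ≡ innerDes x xs + indicator (y <ᵇ lastOf x xs) + innerDes y ys
  innerDes-++ x []        y ys = refl
  innerDes-++ x (x′ ∷ xs) y ys = trans (cong (indicator (x′ <ᵇ x) +_) (innerDes-++ x′ xs y ys))
    (solve 4 (λ a b c d → a :+ (b :+ c :+ d) := a :+ b :+ c :+ d) refl (indicator (x′ <ᵇ x)) _ _ _)

  innerDes-replicate : ∀ N c → innerDes N (replicate c N) ≡ 0
  innerDes-replicate N zero    = refl
  innerDes-replicate N (suc c) rewrite <ᵇ-false (<-irrefl {N} refl) = innerDes-replicate N c

  innerDes-leave-block : ∀ N c {y} ys → y < N → innerDes N (replicate c N ++ y ∷ ys) ≡ suc (innerDes y ys)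
  innerDes-leave-block N zero    ys y<N rewrite <ᵇ-true y<N = refl
  innerDes-leave-block N (suc c) ys y<N rewrite <ᵇ-false (<-irrefl {N} refl) = innerDes-leave-block N c ys y<N

  lastOf-< : ∀ {N} x xs → All (_< N) (x ∷ xs) → lastOf x xs < N
  lastOf-< x []        (x<N ∷ _)  = x<N
  lastOf-< x (x′ ∷ xs) (_ ∷ xs<N) = lastOf-< x′ xs xs<N

  junctionIsDes : List ℕ → List ℕ → Bool
  junctionIsDes []       ys       = false
  junctionIsDes (x ∷ xs) []       = true
  junctionIsDes (x ∷ xs) (y ∷ ys) = y <ᵇ lastOf x xs

  des-block : ∀ N c xs ys → All (_< N) xs → All (_< N) ys →
    des (xs ++ replicate (suc c) N ++ ys) ≡ des (xs ++ ys) + indicator (not (junctionIsDes xs ys))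
  des-block N c [] [] _ _ =
    trans (cong des (++-identityʳ (replicate (suc c) N))) (trans (des-∷ N (replicate c N)) (cong suc (innerDes-replicate N c)))
  des-block N c [] (y ∷ ys) _ (y<N ∷ _) = begin
    des (N ∷ replicate c N ++ y ∷ ys)   ≡⟨ des-∷ N (replicate c N ++ y ∷ ys) ⟩
    suc (innerDes N (replicate c N ++ y ∷ ys))  ≡⟨ cong suc (innerDes-leave-block N c ys y<N) ⟩
    suc (suc (innerDes y ys))           ≡⟨ cong suc (sym (des-∷ y ys)) ⟩
    suc (des (y ∷ ys))                  ≡⟨ +-comm 1 _ ⟩
    des (y ∷ ys) + 1                    ∎
    where open ≡.≡-Reasoning
  des-block N c (x ∷ xs) [] xs<N _ = begin
    des (x ∷ xs ++ N ∷ replicate c N ++ [])   ≡⟨ des-∷ x (xs ++ N ∷ replicate c N ++ []) ⟩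
    suc (innerDes x (xs ++ N ∷ replicate c N ++ []))
      ≡⟨ cong suc (innerDes-++ x xs N (replicate c N ++ [])) ⟩
    suc (innerDes x xs + indicator (N <ᵇ lastOf x xs) + innerDes N (replicate c N ++ []))
      ≡⟨ cong₂ (λ b r → suc (innerDes x xs + indicator b + innerDes N r))
           (<ᵇ-false (<⇒≱ (lastOf-< x xs xs<N) ∘ <⇒≤)) (++-identityʳ (replicate c N)) ⟩
    suc (innerDes x xs + 0 + innerDes N (replicate c N))
      ≡⟨ cong (λ r → suc (innerDes x xs + 0 + r)) (innerDes-replicate N c) ⟩
    suc (innerDes x xs + 0 + 0)   ≡⟨ cong suc (trans (+-identityʳ _) (+-identityʳ _)) ⟩
    suc (innerDes x xs)           ≡⟨ sym (des-∷ x xs) ⟩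
    des (x ∷ xs)                  ≡⟨ cong des (sym (++-identityʳ (x ∷ xs))) ⟩
    des (x ∷ xs ++ [])            ≡⟨ sym (+-identityʳ _) ⟩
    des (x ∷ xs ++ []) + 0        ∎
    where open ≡.≡-Reasoning
  des-block N c (x ∷ xs) (y ∷ ys) xs<N (y<N ∷ _) = begin
    des (x ∷ xs ++ N ∷ replicate c N ++ y ∷ ys)   ≡⟨ des-∷ x (xs ++ N ∷ replicate c N ++ y ∷ ys) ⟩
    suc (innerDes x (xs ++ N ∷ replicate c N ++ y ∷ ys))
      ≡⟨ cong suc (innerDes-++ x xs N (replicate c N ++ y ∷ ys)) ⟩
    suc (innerDes x xs + indicator (N <ᵇ lastOf x xs) + innerDes N (replicate c N ++ y ∷ ys))
      ≡⟨ cong₂ (λ b r → suc (innerDes x xs + indicator b + r))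
           (<ᵇ-false (<⇒≱ (lastOf-< x xs xs<N) ∘ <⇒≤)) (innerDes-leave-block N c ys y<N) ⟩
    suc (innerDes x xs + 0 + suc (innerDes y ys))
      ≡⟨ split (y <ᵇ lastOf x xs) ⟩
    suc (innerDes x xs + indicator (y <ᵇ lastOf x xs) + innerDes y ys) + indicator (not (y <ᵇ lastOf x xs))
      ≡⟨ cong (λ d → suc d + indicator (not (y <ᵇ lastOf x xs))) (sym (innerDes-++ x xs y ys)) ⟩
    suc (innerDes x (xs ++ y ∷ ys)) + indicator (not (y <ᵇ lastOf x xs))
      ≡⟨ cong (_+ indicator (not (y <ᵇ lastOf x xs))) (sym (des-∷ x (xs ++ y ∷ ys))) ⟩
    des (x ∷ xs ++ y ∷ ys) + indicator (not (y <ᵇ lastOf x xs))   ∎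
    where
    open ≡.≡-Reasoning
    split : ∀ b → suc (innerDes x xs + 0 + suc (innerDes y ys))
                ≡ suc (innerDes x xs + indicator b + innerDes y ys) + indicator (not b)
    split true  = solve 2 (λ a d → con 1 :+ (a :+ con 0 :+ (con 1 :+ d)) := con 1 :+ (a :+ con 1 :+ d) :+ con 0) refl
                    (innerDes x xs) (innerDes y ys)
    split false = solve 2 (λ a d → con 1 :+ (a :+ con 0 :+ (con 1 :+ d)) := con 1 :+ (a :+ con 0 :+ d) :+ con 1) refl
                    (innerDes x xs) (innerDes y ys)

  -- Gap p lies before position p of σ, for p = 0, …, length σ.
  gapIsDes : List ℕ → ℕ → Bool
  gapIsDes σ zero    = false
  gapIsDes σ (suc q) = (suc q == length σ) ∨ (at σ (suc q) <ᵇ at σ q)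

  countᵇ-gapIsDes : ∀ σ → countᵇ (gapIsDes σ) (upTo (suc (length σ))) ≡ des σ
  countᵇ-gapIsDes σ = trans (cong (countᵇ (gapIsDes σ)) (sym (map-upTo suc (length σ)))) (countᵇ-map (gapIsDes σ) suc (upTo (length σ)))

  countᵇ-not-gapIsDes : ∀ σ → countᵇ (not ∘ gapIsDes σ) (upTo (suc (length σ))) ≡ suc (length σ) ∸ des σ
  countᵇ-not-gapIsDes σ = begin
    countᵇ (not ∘ gapIsDes σ) gaps                                          ≡⟨ sym (m+n∸m≡n (countᵇ (gapIsDes σ) gaps) _) ⟩
    countᵇ (gapIsDes σ) gaps + countᵇ (not ∘ gapIsDes σ) gaps ∸ countᵇ (gapIsDes σ) gaps
      ≡⟨ cong₂ _∸_ (trans (countᵇ+countᵇ-not (gapIsDes σ) gaps) (length-upTo (suc (length σ)))) (countᵇ-gapIsDes σ) ⟩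
    suc (length σ) ∸ des σ                                                  ∎
    where
    open ≡.≡-Reasoning
    gaps : List ℕ
    gaps = upTo (suc (length σ))

  lastOf-take : ∀ x σ q → q ≤ length σ → lastOf x (take q σ) ≡ at (x ∷ σ) q
  lastOf-take x σ        zero    _         = refl
  lastOf-take x (x′ ∷ σ) (suc q) (s≤s q≤n) = lastOf-take x′ σ q q≤n

  at-drop : ∀ σ q {y ys} → drop q σ ≡ y ∷ ys → at σ q ≡ y
  at-drop (x ∷ σ) zero    refl = refl
  at-drop (x ∷ σ) (suc q) eq   = at-drop σ q eq

  junctionIsDes-take-drop : ∀ σ p → p ≤ length σ → junctionIsDes (take p σ) (drop p σ) ≡ gapIsDes σ p
  junctionIsDes-take-drop σ       zero    _         = refl
  junctionIsDes-take-drop (x ∷ σ) (suc q) (s≤s q≤n) with drop q σ in eq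
  ... | [] = sym (cong (_∨ (at σ q <ᵇ at (x ∷ σ) q)) (trans (==-suc q (length σ)) (reflects-true (==-reflects-≡ q (length σ)) q≡n)))
    where
    q≡n : q ≡ length σ
    q≡n = ≤-antisym q≤n (m∸n≡0⇒m≤n (trans (sym (length-drop q σ)) (cong length eq)))
  ... | y ∷ ys = sym (trans (cong (_∨ (at σ q <ᵇ at (x ∷ σ) q)) (trans (==-suc q (length σ)) (≢⇒==-false q≢n)))
                        (cong₂ _<ᵇ_ (at-drop σ q eq) (sym (lastOf-take x σ q q≤n))))
    where
    q≢n : q ≢ length σ
    q≢n refl = 0≢1+n (sym (trans (cong length (sym eq)) (trans (length-drop q σ) (n∸n≡0 q))))

  des-insertBlock : ∀ c N p σ → All (_< N) σ → p ≤ length σ →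
    des (insertBlock (suc c) N p σ) ≡ des σ + indicator (not (gapIsDes σ p))
  des-insertBlock c N p σ σ<N p≤n = begin
    des (take p σ ++ replicate (suc c) N ++ drop p σ)
      ≡⟨ des-block N c (take p σ) (drop p σ) (Allₚ.take⁺ p σ<N) (Allₚ.drop⁺ p σ<N) ⟩
    des (take p σ ++ drop p σ) + indicator (not (junctionIsDes (take p σ) (drop p σ)))
      ≡⟨ cong₂ (λ w b → des w + indicator (not b)) (take++drop≡id p σ) (junctionIsDes-take-drop σ p p≤n) ⟩
    des σ + indicator (not (gapIsDes σ p)) ∎
    where open ≡.≡-Reasoning

  +-indicator-not-== : ∀ d b i → ((d + indicator (not b)) == i) ≡ (if b then d == i else suc d == i)
  +-indicator-not-== d true  i = cong (_== i) (+-identityʳ d)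
  +-indicator-not-== d false i = cong (_== i) (+-comm d 1)

  -- Of the length σ + 1 gaps of σ, des σ are descents: inserting there keeps the number of descents.
  countᵇ-des-insertBlock : ∀ c N σ i → All (_< N) σ → ∀ {K} → length σ ≡ K →
    countᵇ (λ p → des (insertBlock (suc c) N p σ) == i) (upTo (suc K))
      ≡ des σ * indicator (des σ == i) + (suc K ∸ des σ) * indicator (suc (des σ) == i)
  countᵇ-des-insertBlock c N σ i σ<N refl = begin
    countᵇ (λ p → des (insertBlock (suc c) N p σ) == i) gaps
      ≡⟨ countᵇ-cong-∈ gaps (λ p∈ → trans (cong (_== i) (des-insertBlock c N _ σ σ<N (≤-pred (∈-upTo⁻ p∈))))
                                       (+-indicator-not-== (des σ) _ i)) ⟩
    countᵇ (λ p → if gapIsDes σ p then des σ == i else suc (des σ) == i) gaps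
      ≡⟨ countᵇ-if (gapIsDes σ) (des σ == i) (suc (des σ) == i) gaps ⟩
    indicator (des σ == i) * countᵇ (gapIsDes σ) gaps + indicator (suc (des σ) == i) * countᵇ (not ∘ gapIsDes σ) gaps
      ≡⟨ cong₂ (λ a b → indicator (des σ == i) * a + indicator (suc (des σ) == i) * b)
           (countᵇ-gapIsDes σ) (countᵇ-not-gapIsDes σ) ⟩
    indicator (des σ == i) * des σ + indicator (suc (des σ) == i) * (suc (length σ) ∸ des σ)
      ≡⟨ cong₂ _+_ (*-comm (indicator (des σ == i)) _) (*-comm (indicator (suc (des σ) == i)) _) ⟩
    des σ * indicator (des σ == i) + (suc (length σ) ∸ des σ) * indicator (suc (des σ) == i) ∎
    where
    open ≡.≡-Reasoning
    gaps : List ℕ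
    gaps = upTo (suc (length σ))

  *-indicator-== : ∀ (f : ℕ → ℕ) d i → f d * indicator (d == i) ≡ f i * indicator (d == i)
  *-indicator-== f d i with d == i | ==-reflects-≡ d i
  ... | true  | ofʸ refl = refl
  ... | false | ofⁿ _    = trans (*-zeroʳ (f d)) (sym (*-zeroʳ (f i)))

  A-snoc : ∀ ks kn i → 1 ≤ kn →
    A (ks ∷ʳ kn) i ≡ sum (map (λ σ → des σ * indicator (des σ == i) + (suc (sum ks) ∸ des σ) * indicator (suc (des σ) == i)) (SP ks))
  A-snoc ks (suc c) i 1≤kn = begin
    countᵇ hasI (SP (ks ∷ʳ suc c))        ≡⟨ countᵇ-↭ hasI (SP-snoc↭insertions ks (suc c) 1≤kn) ⟩
    countᵇ hasI (insertions ks (suc c))   ≡⟨ countᵇ-concatMap hasI _ (SP ks) ⟩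
    sum (map (λ σ → countᵇ hasI (map (λ p → insertBlock (suc c) (newLetter ks) p σ) (upTo (suc (sum ks))))) (SP ks))
      ≡⟨ sum-map-cong-∈ (SP ks) per-σ ⟩
    sum (map (λ σ → des σ * indicator (des σ == i) + (suc (sum ks) ∸ des σ) * indicator (suc (des σ) == i)) (SP ks)) ∎
    where
    open ≡.≡-Reasoning
    hasI : List ℕ → Bool
    hasI w = des w == i
    per-σ : ∀ {σ} → σ ∈ SP ks →
      countᵇ hasI (map (λ p → insertBlock (suc c) (newLetter ks) p σ) (upTo (suc (sum ks))))
        ≡ des σ * indicator (des σ == i) + (suc (sum ks) ∸ des σ) * indicator (suc (des σ) == i)
    per-σ {σ} σ∈ with ∈-SP⁻ ks σ∈
    ... | |σ| , lσ , _ = trans (countᵇ-map hasI _ (upTo (suc (sum ks))))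
      (countᵇ-des-insertBlock c (newLetter ks) σ i (All.map (λ (_ , a≤n) → s≤s a≤n) lσ) |σ|)

  A-zero : ∀ k → 0 < sum k → A k 0 ≡ 0
  A-zero k K>0 = countᵇ-false (SP k) λ {w} w∈ → des-nonempty {w} (≤-trans K>0 (≤-reflexive (sym (proj₁ (∈-SP⁻ k w∈)))))
    where
    des-nonempty : ∀ {w} → 0 < length w → (des w == 0) ≡ false
    des-nonempty {x ∷ r} _ rewrite des-∷ x r = refl

  A-snoc-suc : ∀ ks kn j → 1 ≤ kn → A (ks ∷ʳ kn) (suc j) ≡ suc j * A ks (suc j) + (suc (sum ks) ∸ j) * A ks j
  A-snoc-suc ks kn j 1≤kn = begin
    A (ks ∷ʳ kn) (suc j)
      ≡⟨ A-snoc ks kn (suc j) 1≤kn ⟩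
    sum (map (λ σ → des σ * indicator (des σ == suc j) + (suc K ∸ des σ) * indicator (suc (des σ) == suc j)) (SP ks))
      ≡⟨ sum-map-cong-∈ (SP ks) (λ {σ} _ → cong₂ _+_ (*-indicator-== (λ d → d) (des σ) (suc j))
           (trans (cong ((suc K ∸ des σ) *_) (cong indicator (==-suc (des σ) j))) (*-indicator-== (suc K ∸_) (des σ) j))) ⟩
    sum (map (λ σ → suc j * indicator (des σ == suc j) + (suc K ∸ j) * indicator (des σ == j)) (SP ks))
      ≡⟨ sum-map-+ (λ σ → suc j * indicator (des σ == suc j)) (λ σ → (suc K ∸ j) * indicator (des σ == j)) (SP ks) ⟩
    sum (map (λ σ → suc j * indicator (des σ == suc j)) (SP ks)) + sum (map (λ σ → (suc K ∸ j) * indicator (des σ == j)) (SP ks))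
      ≡⟨ cong₂ _+_ (sum-map-indicator (λ σ → des σ == suc j) (suc j) (SP ks))
                   (sum-map-indicator (λ σ → des σ == j) (suc K ∸ j) (SP ks)) ⟩
    suc j * A ks (suc j) + (suc K ∸ j) * A ks j ∎
    where
    open ≡.≡-Reasoning
    K : ℕ
    K = sum ks

  length-concatMap-const : ∀ {X Y : Set} (f : X → List Y) c xs → (∀ {x} → x ∈ xs → length (f x) ≡ c) →
    length (concatMap f xs) ≡ c * length xs
  length-concatMap-const f c []       _   = sym (*-zeroʳ c)
  length-concatMap-const f c (x ∷ xs) |f| = trans (length-++ (f x))
    (trans (cong₂ _+_ (|f| (here refl)) (length-concatMap-const f c xs (|f| ∘ there))) (sym (*-suc c (length xs))))

  length-SP-snoc : ∀ ks kn → 1 ≤ kn → length (SP (ks ∷ʳ kn)) ≡ suc (sum ks) * length (SP ks)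
  length-SP-snoc ks kn 1≤kn = trans (↭-length (SP-snoc↭insertions ks kn 1≤kn))
    (length-concatMap-const _ (suc (sum ks)) (SP ks) λ _ → trans (length-map _ (upTo (suc (sum ks)))) (length-upTo (suc (sum ks))))

  -- Convolution with binomial kernels

  sumTo-suc : ∀ m f → sumTo (suc m) f ≡ sumTo m f + f (suc m)
  sumTo-suc m f = begin
    sum (map f (upTo (suc (suc m))))              ≡⟨ cong (sum ∘ map f) (sym (upTo-∷ʳ (suc m))) ⟩
    sum (map f (upTo (suc m) ++ suc m ∷ []))      ≡⟨ cong sum (map-++ f (upTo (suc m)) _) ⟩
    sum (map f (upTo (suc m)) ++ f (suc m) ∷ [])  ≡⟨ sum-++ (map f (upTo (suc m))) _ ⟩
    sumTo m f + (f (suc m) + 0)                   ≡⟨ cong (sumTo m f +_) (+-identityʳ _) ⟩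
    sumTo m f + f (suc m)                         ∎
    where open ≡.≡-Reasoning

  sumTo-suc′ : ∀ m f → sumTo (suc m) f ≡ f 0 + sumTo m (f ∘ suc)
  sumTo-suc′ m f = cong (f 0 +_) (cong sum (trans (map-applyUpTo suc f (suc m)) (sym (map-upTo (f ∘ suc) (suc m)))))

  sumTo-cong : ∀ m {f g} → (∀ {i} → i ≤ m → f i ≡ g i) → sumTo m f ≡ sumTo m g
  sumTo-cong zero    f≡g = cong (_+ 0) (f≡g z≤n)
  sumTo-cong (suc m) {f} {g} f≡g = trans (sumTo-suc m f)
    (trans (cong₂ _+_ (sumTo-cong m (f≡g ∘ m≤n⇒m≤1+n)) (f≡g ≤-refl)) (sym (sumTo-suc m g)))

  sumTo-+ : ∀ m f g → sumTo m (λ i → f i + g i) ≡ sumTo m f + sumTo m g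
  sumTo-+ zero    f g = solve 2 (λ a b → a :+ b :+ con 0 := a :+ con 0 :+ (b :+ con 0)) refl (f 0) (g 0)
  sumTo-+ (suc m) f g rewrite sumTo-suc m (λ i → f i + g i) | sumTo-suc m f | sumTo-suc m g | sumTo-+ m f g =
    solve 4 (λ a b c d → a :+ b :+ (c :+ d) := a :+ c :+ (b :+ d)) refl (sumTo m f) (sumTo m g) (f (suc m)) (g (suc m))

  sumTo-*ˡ : ∀ m c f → sumTo m (λ i → c * f i) ≡ c * sumTo m f
  sumTo-*ˡ zero    c f = trans (+-identityʳ _) (cong (c *_) (sym (+-identityʳ (f 0))))
  sumTo-*ˡ (suc m) c f rewrite sumTo-suc m (λ i → c * f i) | sumTo-suc m f | sumTo-*ˡ m c f = sym (*-distribˡ-+ c _ _)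

  sumTo-zero : ∀ m {f} → (∀ {i} → i ≤ m → f i ≡ 0) → sumTo m f ≡ 0
  sumTo-zero m f≡0 = trans (sumTo-cong m f≡0) (sumTo-const-0 m)
    where
    sumTo-const-0 : ∀ m → sumTo m (λ _ → 0) ≡ 0
    sumTo-const-0 zero    = refl
    sumTo-const-0 (suc m) = trans (sumTo-suc m (λ _ → 0)) (trans (+-identityʳ _) (sumTo-const-0 m))

  sumTo-≥ : ∀ {m a} f → a ≤ m → (∀ {j} → a < j → f j ≡ 0) → sumTo m f ≡ sumTo a f
  sumTo-≥ {m} {a} f a≤m f≡0 = trans (cong (λ n → sumTo n f) (sym (m+[n∸m]≡n a≤m))) (extend (m ∸ a))
    where
    extend : ∀ d → sumTo (a + d) f ≡ sumTo a f
    extend zero    = cong (λ n → sumTo n f) (+-identityʳ a)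
    extend (suc d) = begin
      sumTo (a + suc d) f                ≡⟨ cong (λ n → sumTo n f) (+-suc a d) ⟩
      sumTo (suc (a + d)) f              ≡⟨ sumTo-suc (a + d) f ⟩
      sumTo (a + d) f + f (suc (a + d))  ≡⟨ cong₂ _+_ (extend d) (f≡0 (s≤s (m≤m+n a d))) ⟩
      sumTo a f + 0                      ≡⟨ +-identityʳ _ ⟩
      sumTo a f                          ∎
      where open ≡.≡-Reasoning

  sumTo-reverse : ∀ m f → sumTo m (λ j → f (m ∸ j)) ≡ sumTo m f
  sumTo-reverse zero    f = refl
  sumTo-reverse (suc m) f = begin
    sumTo (suc m) (λ j → f (suc m ∸ j))  ≡⟨ sumTo-suc′ m (λ j → f (suc m ∸ j)) ⟩
    f (suc m) + sumTo m (λ j → f (m ∸ j)) ≡⟨ cong (f (suc m) +_) (sumTo-reverse m f) ⟩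
    f (suc m) + sumTo m f                 ≡⟨ +-comm (f (suc m)) _ ⟩
    sumTo m f + f (suc m)                 ≡⟨ sym (sumTo-suc m f) ⟩
    sumTo (suc m) f                       ∎
    where open ≡.≡-Reasoning

  -- The coefficient of xᵐ in the product of the series Σ f i xⁱ and Σ h j xʲ.
  conv : (ℕ → ℕ) → (ℕ → ℕ) → ℕ → ℕ
  conv f h m = sumTo m (λ i → f i * h (m ∸ i))

  conv-congˡ : ∀ {f g} h m → (∀ {i} → i ≤ m → f i ≡ g i) → conv f h m ≡ conv g h m
  conv-congˡ h m f≡g = sumTo-cong m (λ i≤m → cong (_* h _) (f≡g i≤m))

  conv-congʳ : ∀ f {h k} m → (∀ {j} → j ≤ m → h j ≡ k j) → conv f h m ≡ conv f k m
  conv-congʳ f m h≡k = sumTo-cong m (λ {i} _ → cong (f i *_) (h≡k (m∸n≤m m i)))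

  conv-+ˡ : ∀ f g h m → conv (λ i → f i + g i) h m ≡ conv f h m + conv g h m
  conv-+ˡ f g h m = trans (sumTo-cong m (λ {i} _ → *-distribʳ-+ (h (m ∸ i)) (f i) (g i)))
    (sumTo-+ m (λ i → f i * h (m ∸ i)) (λ i → g i * h (m ∸ i)))

  conv-+ʳ : ∀ f g h m → conv f (λ j → g j + h j) m ≡ conv f g m + conv f h m
  conv-+ʳ f g h m = trans (sumTo-cong m (λ {i} _ → *-distribˡ-+ (f i) (g (m ∸ i)) (h (m ∸ i))))
    (sumTo-+ m (λ i → f i * g (m ∸ i)) (λ i → f i * h (m ∸ i)))

  conv-suc : ∀ f h m → conv f h (suc m) ≡ conv f (h ∘ suc) m + f (suc m) * h 0
  conv-suc f h m = trans (sumTo-suc m (λ i → f i * h (suc m ∸ i))) (cong₂ _+_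
    (sumTo-cong m (λ {i} i≤m → cong (λ a → f i * h a) (+-∸-assoc 1 i≤m)))
    (cong (λ a → f (suc m) * h a) (n∸n≡0 m)))

  conv-suc′ : ∀ f h m → conv f h (suc m) ≡ f 0 * h (suc m) + conv (f ∘ suc) h m
  conv-suc′ f h m = sumTo-suc′ m (λ i → f i * h (suc m ∸ i))

  -- The coefficient of xᵃ in (1 - x)^-(b+1).
  C⁺ : ℕ → ℕ → ℕ
  C⁺ zero    b       = 1
  C⁺ (suc a) zero    = 1
  C⁺ (suc a) (suc b) = C⁺ a (suc b) + C⁺ (suc a) b

  -- The coefficient of xᵐ in f(x) (1 - x)^-(K+1).
  coeffDiv⁺ : (ℕ → ℕ) → ℕ → ℕ → ℕ
  coeffDiv⁺ f K = conv f (λ a → C⁺ a K)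

  C⁺-zeroʳ : ∀ a → C⁺ a 0 ≡ 1
  C⁺-zeroʳ zero    = refl
  C⁺-zeroʳ (suc a) = refl

  C⁺≡C : ∀ a b → C⁺ a b ≡ (a + b) C b
  C⁺≡C zero    b       = sym (nCn≡1 b)
  C⁺≡C (suc a) zero    = refl
  C⁺≡C (suc a) (suc b) = begin
    C⁺ a (suc b) + C⁺ (suc a) b                ≡⟨ cong₂ _+_ (C⁺≡C a (suc b)) (C⁺≡C (suc a) b) ⟩
    (a + suc b) C suc b + (suc a + b) C b      ≡⟨ cong (λ n → n C suc b + (suc a + b) C b) (+-suc a b) ⟩
    (suc a + b) C suc b + (suc a + b) C b      ≡⟨ +-comm ((suc a + b) C suc b) _ ⟩
    (suc a + b) C b + (suc a + b) C suc b      ≡⟨ nCk+nC[k+1]≡[n+1]C[k+1] (suc a + b) b ⟩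
    suc (suc a + b) C suc b                    ≡⟨ cong (λ n → suc n C suc b) (sym (+-suc a b)) ⟩
    (suc a + suc b) C suc b                    ∎
    where open ≡.≡-Reasoning

  C⁺-sym : ∀ a b → C⁺ a b ≡ C⁺ b a
  C⁺-sym zero    zero    = refl
  C⁺-sym zero    (suc b) = refl
  C⁺-sym (suc a) zero    = refl
  C⁺-sym (suc a) (suc b) = trans (cong₂ _+_ (C⁺-sym a (suc b)) (C⁺-sym (suc a) b)) (+-comm (C⁺ (suc b) a) _)

  C⁺-absorb : ∀ a b → suc b * C⁺ a (suc b) ≡ suc (a + b) * C⁺ a b
  C⁺-absorb zero    b       = refl
  C⁺-absorb (suc a) zero    =
    trans (+-identityʳ (C⁺ (suc a) 1)) (trans (C⁺-1 (suc a)) (sym (trans (*-identityʳ _) (cong (suc ∘ suc) (+-identityʳ a)))))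
    where
    C⁺-1 : ∀ a → C⁺ a 1 ≡ suc a
    C⁺-1 zero    = refl
    C⁺-1 (suc a) = trans (cong (_+ 1) (C⁺-1 a)) (+-comm (suc a) 1)
  C⁺-absorb (suc a) (suc b) = begin
    suc (suc b) * (C⁺ a (suc (suc b)) + Y)
      ≡⟨ solve 3 (λ b x y → (con 2 :+ b) :* (x :+ y) := (con 2 :+ b) :* x :+ (con 1 :+ b) :* y :+ y) refl
           b (C⁺ a (suc (suc b))) Y ⟩
    suc (suc b) * C⁺ a (suc (suc b)) + suc b * Y + Y
      ≡⟨ cong₂ (λ u v → u + v + Y) (C⁺-absorb a (suc b)) (C⁺-absorb (suc a) b) ⟩
    suc (a + suc b) * C⁺ a (suc b) + s * C⁺ (suc a) b + Y
      ≡⟨ cong (λ n → suc n * C⁺ a (suc b) + s * C⁺ (suc a) b + Y) (+-suc a b) ⟩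
    s * C⁺ a (suc b) + s * C⁺ (suc a) b + Y
      ≡⟨ solve 3 (λ s x y → s :* x :+ s :* y :+ (x :+ y) := (con 1 :+ s) :* (x :+ y)) refl s (C⁺ a (suc b)) (C⁺ (suc a) b) ⟩
    suc s * Y
      ≡⟨ cong (λ n → suc n * Y) (sym (+-suc (suc a) b)) ⟩
    suc (suc a + suc b) * Y ∎
    where
    open ≡.≡-Reasoning
    Y s : ℕ
    Y = C⁺ (suc a) (suc b)
    s = suc (suc a + b)

  C⁺-absorb-swap : ∀ a b → suc b * C⁺ a (suc b) ≡ suc a * C⁺ (suc a) b
  C⁺-absorb-swap a b = begin
    suc b * C⁺ a (suc b)   ≡⟨ C⁺-absorb a b ⟩
    suc (a + b) * C⁺ a b   ≡⟨ cong₂ (λ n c → suc n * c) (+-comm a b) (C⁺-sym a b) ⟩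
    suc (b + a) * C⁺ b a   ≡⟨ sym (C⁺-absorb b a) ⟩
    suc a * C⁺ b (suc a)   ≡⟨ cong (suc a *_) (C⁺-sym b (suc a)) ⟩
    suc a * C⁺ (suc a) b   ∎
    where open ≡.≡-Reasoning

  coeffDiv⁺-pascal : ∀ f K m →
    coeffDiv⁺ f (suc K) (suc m) ≡ coeffDiv⁺ f (suc K) m + coeffDiv⁺ f K (suc m)
  coeffDiv⁺-pascal f K m = begin
    coeffDiv⁺ f (suc K) (suc m)
      ≡⟨ conv-suc f (λ a → C⁺ a (suc K)) m ⟩
    conv f (λ a → C⁺ a (suc K) + C⁺ (suc a) K) m + f (suc m) * 1
      ≡⟨ cong (_+ f (suc m) * 1) (conv-+ʳ f (λ a → C⁺ a (suc K)) (λ a → C⁺ (suc a) K) m) ⟩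
    coeffDiv⁺ f (suc K) m + conv f (λ a → C⁺ (suc a) K) m + f (suc m) * 1
      ≡⟨ +-assoc (coeffDiv⁺ f (suc K) m) _ _ ⟩
    coeffDiv⁺ f (suc K) m + (conv f (λ a → C⁺ (suc a) K) m + f (suc m) * 1)
      ≡⟨ cong (coeffDiv⁺ f (suc K) m +_) (sym (conv-suc f (λ a → C⁺ a K) m)) ⟩
    coeffDiv⁺ f (suc K) m + coeffDiv⁺ f K (suc m) ∎
    where open ≡.≡-Reasoning

  conv-C-pascal : ∀ f K m → conv f (_C suc K) (suc m) ≡ conv f (_C suc K) m + conv f (_C K) m
  conv-C-pascal f K m = begin
    conv f (_C suc K) (suc m)
      ≡⟨ conv-suc f (_C suc K) m ⟩
    conv f (λ a → suc a C suc K) m + f (suc m) * 0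
      ≡⟨ cong₂ _+_ (conv-congʳ f m (λ {a} _ → sym (nCk+nC[k+1]≡[n+1]C[k+1] a K))) (*-zeroʳ (f (suc m))) ⟩
    conv f (λ a → a C K + a C suc K) m + 0
      ≡⟨ +-identityʳ _ ⟩
    conv f (λ a → a C K + a C suc K) m
      ≡⟨ conv-+ʳ f (_C K) (_C suc K) m ⟩
    conv f (_C K) m + conv f (_C suc K) m
      ≡⟨ +-comm (conv f (_C K) m) _ ⟩
    conv f (_C suc K) m + conv f (_C K) m ∎
    where open ≡.≡-Reasoning

  C⁺-eulerian : ∀ K a i → i ≤ suc K →
    i * C⁺ (suc a) (suc K) + (suc K ∸ i) * C⁺ a (suc K) ≡ suc (i + a) * C⁺ (suc a) K
  C⁺-eulerian K a i i≤K+1 = begin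
    i * (X + Y) + (suc K ∸ i) * X
      ≡⟨ solve 4 (λ i r X Y → i :* (X :+ Y) :+ r :* X := (i :+ r) :* X :+ i :* Y) refl i (suc K ∸ i) X Y ⟩
    (i + (suc K ∸ i)) * X + i * Y   ≡⟨ cong (λ n → n * X + i * Y) (m+[n∸m]≡n i≤K+1) ⟩
    suc K * X + i * Y               ≡⟨ cong (_+ i * Y) (C⁺-absorb-swap a K) ⟩
    suc a * Y + i * Y               ≡⟨ solve 3 (λ a i Y → (con 1 :+ a) :* Y :+ i :* Y := (con 1 :+ (i :+ a)) :* Y) refl a i Y ⟩
    suc (i + a) * Y                 ∎
    where
    open ≡.≡-Reasoning
    X Y : ℕ
    X = C⁺ a (suc K)
    Y = C⁺ (suc a) K

  eulerian-summand : ∀ K {c : ℕ → ℕ} {i} → (suc K < i → c i ≡ 0) → ∀ {m} → i ≤ m →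
    i * c i * C⁺ (suc (m ∸ i)) (suc K) + (suc K ∸ i) * c i * C⁺ (m ∸ i) (suc K)
      ≡ suc m * (c i * C⁺ (suc (m ∸ i)) K)
  eulerian-summand K {c} {i} c-vanish {m} i≤m with suc K <? i
  ... | yes K+1<i rewrite c-vanish K+1<i =
    solve 6 (λ i r m x y z → i :* con 0 :* x :+ r :* con 0 :* y := m :* (con 0 :* z)) refl
      i (suc K ∸ i) (suc m) (C⁺ (suc (m ∸ i)) (suc K)) (C⁺ (m ∸ i) (suc K)) (C⁺ (suc (m ∸ i)) K)
  ... | no  K+1≮i = begin
    i * c i * C⁺ (suc a) (suc K) + (suc K ∸ i) * c i * C⁺ a (suc K)
      ≡⟨ solve 5 (λ i r ci x y → i :* ci :* x :+ r :* ci :* y := ci :* (i :* x :+ r :* y)) refl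
           i (suc K ∸ i) (c i) (C⁺ (suc a) (suc K)) (C⁺ a (suc K)) ⟩
    c i * (i * C⁺ (suc a) (suc K) + (suc K ∸ i) * C⁺ a (suc K))
      ≡⟨ cong (c i *_) (C⁺-eulerian K a i (≮⇒≥ K+1≮i)) ⟩
    c i * (suc (i + a) * C⁺ (suc a) K)
      ≡⟨ cong (λ n → c i * (suc n * C⁺ (suc a) K)) (m+[n∸m]≡n i≤m) ⟩
    c i * (suc m * C⁺ (suc a) K)
      ≡⟨ solve 3 (λ ci m e → ci :* (m :* e) := m :* (ci :* e)) refl (c i) (suc m) (C⁺ (suc a) K) ⟩
    suc m * (c i * C⁺ (suc a) K) ∎
    where
    open ≡.≡-Reasoning
    a : ℕ
    a = m ∸ i

  -- In series terms, the hypotheses say d(x) = x (1 - x) c′(x) + (K + 1) x c(x),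
  -- so that d(x) (1 - x)^-(K+2) = x · d/dx [c(x) (1 - x)^-(K+1)].
  coeffDiv⁺-eulerian : ∀ K c d → (∀ {i} → suc K < i → c i ≡ 0) → d 0 ≡ 0 →
    (∀ i → d (suc i) ≡ suc i * c (suc i) + (suc K ∸ i) * c i) →
    ∀ m → coeffDiv⁺ d (suc K) m ≡ m * coeffDiv⁺ c K m
  coeffDiv⁺-eulerian K c d c-vanish d0 d-rec zero = trans (+-identityʳ _) (cong (_* 1) d0)
  coeffDiv⁺-eulerian K c d c-vanish d0 d-rec (suc m) = begin
    conv d E′ (suc m)
      ≡⟨ conv-suc′ d E′ m ⟩
    d 0 * E′ (suc m) + conv (d ∘ suc) E′ m
      ≡⟨ cong₂ _+_ (cong (_* E′ (suc m)) d0) (conv-congˡ E′ m (λ {i} _ → d-rec i)) ⟩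
    conv (λ i → suc i * c (suc i) + c′ i) E′ m
      ≡⟨ conv-+ˡ (λ i → suc i * c (suc i)) c′ E′ m ⟩
    conv (λ i → suc i * c (suc i)) E′ m + conv c′ E′ m
      ≡⟨ cong (_+ conv c′ E′ m) (trans (sym (conv-suc′ ic E′ m)) (conv-suc ic E′ m)) ⟩
    conv ic (E′ ∘ suc) m + suc m * c (suc m) * 1 + conv c′ E′ m
      ≡⟨ solve 3 (λ x y z → x :+ y :+ z := x :+ z :+ y) refl (conv ic (E′ ∘ suc) m) (suc m * c (suc m) * 1) (conv c′ E′ m) ⟩
    conv ic (E′ ∘ suc) m + conv c′ E′ m + suc m * c (suc m) * 1
      ≡⟨ cong₂ _+_ summands (*-assoc (suc m) (c (suc m)) 1) ⟩
    suc m * conv c (E ∘ suc) m + suc m * (c (suc m) * E 0)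
      ≡⟨ sym (*-distribˡ-+ (suc m) (conv c (E ∘ suc) m) (c (suc m) * E 0)) ⟩
    suc m * (conv c (E ∘ suc) m + c (suc m) * E 0)
      ≡⟨ cong (suc m *_) (sym (conv-suc c E m)) ⟩
    suc m * conv c E (suc m) ∎
    where
    open ≡.≡-Reasoning
    E E′ ic c′ : ℕ → ℕ
    E  a = C⁺ a K
    E′ a = C⁺ a (suc K)
    ic i = i * c i
    c′ i = (suc K ∸ i) * c i
    summands : conv ic (E′ ∘ suc) m + conv c′ E′ m ≡ suc m * conv c (E ∘ suc) m
    summands = begin
      conv ic (E′ ∘ suc) m + conv c′ E′ m
        ≡⟨ sumTo-+ m (λ i → ic i * E′ (suc (m ∸ i))) (λ i → c′ i * E′ (m ∸ i)) ⟨
      sumTo m (λ i → ic i * E′ (suc (m ∸ i)) + c′ i * E′ (m ∸ i))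
        ≡⟨ sumTo-cong m (eulerian-summand K {c} c-vanish) ⟩
      sumTo m (λ i → suc m * (c i * E (suc (m ∸ i))))
        ≡⟨ sumTo-*ˡ m (suc m) (λ i → c i * E (suc (m ∸ i))) ⟩
      suc m * conv c (E ∘ suc) m ∎

  coeffDiv⁺-congˡ : ∀ {f g} K m → (∀ {i} → i ≤ m → f i ≡ g i) → coeffDiv⁺ f K m ≡ coeffDiv⁺ g K m
  coeffDiv⁺-congˡ K = conv-congˡ (λ a → C⁺ a K)

  -- The sequences B and b

  length≤sum : ∀ {k} → All (1 ≤_) k → length k ≤ sum k
  length≤sum []         = z≤n
  length≤sum (1≤x ∷ k≥1) = +-mono-≤ 1≤x (length≤sum k≥1)

  A-vanishes : ∀ {k} → All (1 ≤_) k → ∀ {i} → length k < i → A k i ≡ 0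
  A-vanishes {k} = go (reverseView k)
    where
    go : ∀ {k} → Reverse k → All (1 ≤_) k → ∀ {i} → length k < i → A k i ≡ 0
    go []             _   {suc i} _      = refl
    go (ks ∶ r ∶ʳ kn) k≥1 {suc j} n+1<j+1 with Allₚ.∷ʳ⁻ k≥1
    ... | ks≥1 , kn≥1 = trans (A-snoc-suc ks kn j kn≥1) (cong₂ _+_
                          (trans (cong (suc j *_) (go r ks≥1 (m<n⇒m<1+n n<j))) (*-zeroʳ (suc j)))
                          (trans (cong ((suc (sum ks) ∸ j) *_) (go r ks≥1 n<j)) (*-zeroʳ (suc (sum ks) ∸ j))))
      where
      n<j : length ks < j
      n<j = ≤-pred (subst (_< suc j) (length-snoc ks kn) n+1<j+1)

  coeffDiv≡coeffDiv⁺ : ∀ p K m → coeffDiv p K m ≡ coeffDiv⁺ p K m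
  coeffDiv≡coeffDiv⁺ p K m = sumTo-cong m (λ {i} _ → cong (p i *_) (sym (C⁺≡C (m ∸ i) K)))

  numG≡A : ∀ {k} → All (1 ≤_) k → 0 < sum k → ∀ i → numG k i ≡ A k i
  numG≡A {k} k≥1 K>0 zero    = sym (A-zero k K>0)
  numG≡A {k} k≥1 K>0 (suc i) with suc i ≤ᵇ length k | ≤ᵇ-reflects-≤ (suc i) (length k)
  ... | true  | _        = refl
  ... | false | ofⁿ i≰n = sym (A-vanishes k≥1 (≰⇒> i≰n))

  -- The numerator of g_k, Σ A_{k,K+1-i} xⁱ, read as a sequence.
  Ā : List ℕ → ℕ → ℕ
  Ā k i = A k (suc (sum k) ∸ i)

  numg≡Ā : ∀ {k} → All (1 ≤_) k → 0 < sum k → ∀ i → numg k i ≡ Ā k i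
  numg≡Ā {k} k≥1 K>0 i with suc (sum k ∸ length k) ≤? i | i ≤? sum k
  ... | yes K-n<i | yes i≤K rewrite ≤ᵇ-true K-n<i | ≤ᵇ-true i≤K = refl
  ... | yes K-n<i | no  i≰K rewrite ≤ᵇ-true K-n<i | ≤ᵇ-false i≰K =
    sym (trans (cong (A k) (m≤n⇒m∸n≡0 (≰⇒> i≰K))) (A-zero k K>0))
  ... | no  K-n≮i | _ rewrite ≤ᵇ-false K-n≮i = sym (A-vanishes k≥1 (begin-strict
    length k                    ≡⟨ sym (m∸[m∸n]≡n (length≤sum k≥1)) ⟩
    sum k ∸ (sum k ∸ length k)  ≤⟨ ∸-monoʳ-≤ (sum k) i≤K-n ⟩
    sum k ∸ i                   <⟨ ≤-reflexive (sym (+-∸-assoc 1 (≤-trans i≤K-n (m∸n≤m (sum k) (length k))))) ⟩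
    suc (sum k) ∸ i             ∎))
    where
    open ≤-Reasoning
    i≤K-n : i ≤ sum k ∸ length k
    i≤K-n = ≤-pred (≰⇒> K-n≮i)

  B≡coeffDiv⁺ : ∀ {k} → All (1 ≤_) k → ∀ {K} → sum k ≡ K → ∀ m → B k m ≡ coeffDiv⁺ (A k) K m
  B≡coeffDiv⁺ {[]}     _                  refl zero    = refl
  B≡coeffDiv⁺ {[]}     _                  refl (suc m) =
    sym (trans (conv-suc′ (A []) (λ a → C⁺ a 0) m) (cong (1 +_) (sumTo-zero m (λ _ → refl))))
  B≡coeffDiv⁺ {x ∷ xs} k≥1@(1≤x ∷ _) refl m = trans (coeffDiv≡coeffDiv⁺ (numG (x ∷ xs)) (sum (x ∷ xs)) m)
    (coeffDiv⁺-congˡ (sum (x ∷ xs)) m λ {i} _ → numG≡A k≥1 (≤-trans 1≤x (m≤m+n x _)) i)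

  b≡coeffDiv⁺ : ∀ {k} → All (1 ≤_) k → 0 < length k → ∀ {K} → sum k ≡ K → ∀ m → b k m ≡ coeffDiv⁺ (Ā k) K m
  b≡coeffDiv⁺ {x ∷ xs} k≥1@(1≤x ∷ _) _ refl m = trans (coeffDiv≡coeffDiv⁺ (numg (x ∷ xs)) (sum (x ∷ xs)) m)
    (coeffDiv⁺-congˡ (sum (x ∷ xs)) m λ {i} _ → numg≡Ā k≥1 (≤-trans 1≤x (m≤m+n x _)) i)

  sum-snoc-positive : ∀ ks {kn} → 1 ≤ kn → 0 < sum (ks ∷ʳ kn)
  sum-snoc-positive ks {kn} 1≤kn = ≤-trans 1≤kn (≤-trans (m≤n+m kn (sum ks)) (≤-reflexive (sym (sum-snoc ks kn))))

  sum-snoc-suc : ∀ ks k → sum (ks ∷ʳ suc k) ≡ suc (sum (ks ∷ʳ k))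
  sum-snoc-suc ks k = trans (sum-snoc ks (suc k)) (trans (+-suc (sum ks) k) (cong suc (sym (sum-snoc ks k))))

  sum-snoc-1 : ∀ ks → sum (ks ∷ʳ 1) ≡ suc (sum ks)
  sum-snoc-1 ks = trans (sum-snoc ks 1) (+-comm (sum ks) 1)

  A-snoc-suc-last : ∀ ks k i → A (ks ∷ʳ suc (suc k)) i ≡ A (ks ∷ʳ suc k) i
  A-snoc-suc-last ks k zero    =
    trans (A-zero (ks ∷ʳ suc (suc k)) (sum-snoc-positive ks (s≤s z≤n))) (sym (A-zero (ks ∷ʳ suc k) (sum-snoc-positive ks (s≤s z≤n))))
  A-snoc-suc-last ks k (suc j) = trans (A-snoc-suc ks _ j (s≤s z≤n)) (sym (A-snoc-suc ks _ j (s≤s z≤n)))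

  Ā-snoc-suc-last : ∀ ks k i → Ā (ks ∷ʳ suc (suc k)) (suc i) ≡ Ā (ks ∷ʳ suc k) i
  Ā-snoc-suc-last ks k i = trans (cong (λ K → A (ks ∷ʳ suc (suc k)) (K ∸ i)) (sum-snoc-suc ks (suc k))) (A-snoc-suc-last ks k _)

  -- The recursion of A-snoc-suc, read backwards.
  Ā-snoc-one-suc : ∀ ks → 0 < sum ks → ∀ i → Ā (ks ∷ʳ 1) (suc i) ≡ suc i * Ā ks (suc i) + (suc (sum ks) ∸ i) * Ā ks i
  Ā-snoc-one-suc ks K>0 i with i ≤? sum ks
  ... | yes i≤K = begin
    A (ks ∷ʳ 1) (sum (ks ∷ʳ 1) ∸ i)       ≡⟨ cong (λ K → A (ks ∷ʳ 1) (K ∸ i)) (sum-snoc-1 ks) ⟩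
    A (ks ∷ʳ 1) (suc K ∸ i)               ≡⟨ cong (A (ks ∷ʳ 1)) (+-∸-assoc 1 i≤K) ⟩
    A (ks ∷ʳ 1) (suc (K ∸ i))             ≡⟨ A-snoc-suc ks 1 (K ∸ i) (s≤s z≤n) ⟩
    suc (K ∸ i) * A ks (suc (K ∸ i)) + (suc K ∸ (K ∸ i)) * A ks (K ∸ i)
      ≡⟨ cong₂ (λ a b → a * A ks a + b * A ks (K ∸ i))
           (sym (+-∸-assoc 1 i≤K)) (trans (+-∸-assoc 1 (m∸n≤m K i)) (cong suc (m∸[m∸n]≡n i≤K))) ⟩
    (suc K ∸ i) * A ks (suc K ∸ i) + suc i * A ks (K ∸ i)
      ≡⟨ +-comm ((suc K ∸ i) * A ks (suc K ∸ i)) _ ⟩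
    suc i * A ks (K ∸ i) + (suc K ∸ i) * A ks (suc K ∸ i) ∎
    where
    open ≡.≡-Reasoning
    K : ℕ
    K = sum ks
  ... | no i≰K = begin
    A (ks ∷ʳ 1) (sum (ks ∷ʳ 1) ∸ i)
      ≡⟨ cong (A (ks ∷ʳ 1)) (m≤n⇒m∸n≡0 (≤-trans (≤-reflexive (sum-snoc-1 ks)) (≰⇒> i≰K))) ⟩
    A (ks ∷ʳ 1) 0                     ≡⟨ A-zero (ks ∷ʳ 1) (sum-snoc-positive ks (s≤s z≤n)) ⟩
    0                                 ≡⟨ sym (trans (cong₂ (λ a b → suc i * a + (suc K ∸ i) * b) Āᵢ₊₁≡0 Āᵢ≡0)
                                                    (cong₂ _+_ (*-zeroʳ (suc i)) (*-zeroʳ (suc K ∸ i)))) ⟩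
    suc i * Ā ks (suc i) + (suc K ∸ i) * Ā ks i ∎
    where
    open ≡.≡-Reasoning
    K : ℕ
    K = sum ks
    Āᵢ₊₁≡0 : Ā ks (suc i) ≡ 0
    Āᵢ₊₁≡0 = trans (cong (A ks) (m≤n⇒m∸n≡0 (<⇒≤ (≰⇒> i≰K)))) (A-zero ks K>0)
    Āᵢ≡0 : Ā ks i ≡ 0
    Āᵢ≡0 = trans (cong (A ks) (m≤n⇒m∸n≡0 (≰⇒> i≰K))) (A-zero ks K>0)

  b-snoc-one : ∀ {ks} → All (1 ≤_) ks → ∀ m → b (ks ∷ʳ 1) m ≡ m * b ks m
  b-snoc-one {[]} _ m = begin
    b (1 ∷ []) m                          ≡⟨ b≡coeffDiv⁺ (s≤s z≤n ∷ []) (s≤s z≤n) refl m ⟩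
    coeffDiv⁺ (Ā (1 ∷ [])) 1 m            ≡⟨ coeffDiv⁺-eulerian 0 (A []) (Ā (1 ∷ [])) A-vanishes-1 Ā₁-zero Ā₁-suc m ⟩
    m * coeffDiv⁺ (A []) 0 m              ≡⟨ cong (m *_) (sym (B≡coeffDiv⁺ [] refl m)) ⟩
    m * 1                                 ∎
    where
    open ≡.≡-Reasoning
    A-vanishes-1 : ∀ {i} → 1 < i → A [] i ≡ 0
    A-vanishes-1 {suc (suc _)} _         = refl
    A-vanishes-1 {suc zero}    (s≤s ())
    Ā₁-zero : Ā (1 ∷ []) 0 ≡ 0
    Ā₁-zero = A-vanishes {1 ∷ []} (s≤s z≤n ∷ []) {2} (s≤s (s≤s z≤n))
    Ā₁-suc : ∀ i → Ā (1 ∷ []) (suc i) ≡ suc i * A [] (suc i) + (1 ∸ i) * A [] i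
    Ā₁-suc zero    = A-snoc-suc [] 1 0 (s≤s z≤n)
    Ā₁-suc (suc i) = trans (cong (A (1 ∷ [])) (0∸n≡0 i))
      (trans (A-zero (1 ∷ []) (s≤s z≤n)) (sym (cong₂ _+_ (*-zeroʳ (suc (suc i))) (*-zeroʳ (0 ∸ i)))))
  b-snoc-one {ks@(x ∷ xs)} ks≥1@(1≤x ∷ _) m = begin
    b (ks ∷ʳ 1) m
      ≡⟨ b≡coeffDiv⁺ ks∷1≥1 (subst (0 <_) (sym (length-snoc ks 1)) (s≤s z≤n)) (sum-snoc-1 ks) m ⟩
    coeffDiv⁺ (Ā (ks ∷ʳ 1)) (suc (sum ks)) m
      ≡⟨ coeffDiv⁺-eulerian (sum ks) (Ā ks) (Ā (ks ∷ʳ 1))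
           (λ K<i → trans (cong (A ks) (m≤n⇒m∸n≡0 (<⇒≤ K<i))) (A-zero ks K>0))
           (A-vanishes ks∷1≥1 (s≤s (length≤sum ks∷1≥1))) (Ā-snoc-one-suc ks K>0) m ⟩
    m * coeffDiv⁺ (Ā ks) (sum ks) m              ≡⟨ cong (m *_) (sym (b≡coeffDiv⁺ ks≥1 (s≤s z≤n) refl m)) ⟩
    m * b ks m                                   ∎
    where
    open ≡.≡-Reasoning
    ks∷1≥1 : All (1 ≤_) (ks ∷ʳ 1)
    ks∷1≥1 = Allₚ.∷ʳ⁺ ks≥1 (s≤s z≤n)
    K>0 : 0 < sum ks
    K>0 = ≤-trans 1≤x (m≤m+n x (sum xs))

  module _ {ks} (ks≥1 : All (1 ≤_) ks) where

    private
      snoc≥1 : ∀ {kn} → 1 ≤ kn → All (1 ≤_) (ks ∷ʳ kn)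
      snoc≥1 = Allₚ.∷ʳ⁺ ks≥1

      snoc-nonempty : ∀ kn → 0 < length (ks ∷ʳ kn)
      snoc-nonempty kn = subst (0 <_) (sym (length-snoc ks kn)) (s≤s z≤n)

    B-snoc-zero : ∀ {kn} → 1 ≤ kn → B (ks ∷ʳ kn) 0 ≡ 0
    B-snoc-zero {kn} 1≤kn = trans (B≡coeffDiv⁺ (snoc≥1 1≤kn) refl 0)
      (trans (+-identityʳ _) (trans (*-identityʳ _) (A-zero (ks ∷ʳ kn) (sum-snoc-positive ks 1≤kn))))

    b-snoc-zero : ∀ {kn} → 1 ≤ kn → b (ks ∷ʳ kn) 0 ≡ 0
    b-snoc-zero {kn} 1≤kn = trans (b≡coeffDiv⁺ (snoc≥1 1≤kn) (snoc-nonempty kn) refl 0)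
      (trans (+-identityʳ _) (trans (*-identityʳ _) (A-vanishes (snoc≥1 1≤kn) (s≤s (length≤sum (snoc≥1 1≤kn))))))

    B-snoc-pascal : ∀ k m → B (ks ∷ʳ suc (suc k)) (suc m) ≡ B (ks ∷ʳ suc (suc k)) m + B (ks ∷ʳ suc k) (suc m)
    B-snoc-pascal k m = begin
      B k″ (suc m)                                           ≡⟨ B≡coeffDiv⁺ (snoc≥1 (s≤s z≤n)) (sum-snoc-suc ks (suc k)) (suc m) ⟩
      coeffDiv⁺ (A k″) (suc K′) (suc m)                      ≡⟨ coeffDiv⁺-pascal (A k″) K′ m ⟩
      coeffDiv⁺ (A k″) (suc K′) m + coeffDiv⁺ (A k″) K′ (suc m)
        ≡⟨ cong (coeffDiv⁺ (A k″) (suc K′) m +_) (coeffDiv⁺-congˡ K′ (suc m) (λ {i} _ → A-snoc-suc-last ks k i)) ⟩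
      coeffDiv⁺ (A k″) (suc K′) m + coeffDiv⁺ (A k′) K′ (suc m)
        ≡⟨ cong₂ _+_ (sym (B≡coeffDiv⁺ (snoc≥1 (s≤s z≤n)) (sum-snoc-suc ks (suc k)) m))
                     (sym (B≡coeffDiv⁺ (snoc≥1 (s≤s z≤n)) refl (suc m))) ⟩
      B k″ m + B k′ (suc m)                                  ∎
      where
      open ≡.≡-Reasoning
      k′ k″ : List ℕ
      k′ = ks ∷ʳ suc k
      k″ = ks ∷ʳ suc (suc k)
      K′ : ℕ
      K′ = sum k′

    B-snoc-one : ∀ m → B (ks ∷ʳ 1) m ≡ m * B ks m
    B-snoc-one m = begin
      B (ks ∷ʳ 1) m                               ≡⟨ B≡coeffDiv⁺ (snoc≥1 (s≤s z≤n)) (sum-snoc-1 ks) m ⟩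
      coeffDiv⁺ (A (ks ∷ʳ 1)) (suc (sum ks)) m
        ≡⟨ coeffDiv⁺-eulerian (sum ks) (A ks) (A (ks ∷ʳ 1))
             (λ K<i → A-vanishes ks≥1 (<-≤-trans (s≤s (length≤sum ks≥1)) (<⇒≤ K<i)))
             (A-zero (ks ∷ʳ 1) (sum-snoc-positive ks (s≤s z≤n))) (λ i → A-snoc-suc ks 1 i (s≤s z≤n)) m ⟩
      m * coeffDiv⁺ (A ks) (sum ks) m             ≡⟨ cong (m *_) (sym (B≡coeffDiv⁺ ks≥1 refl m)) ⟩
      m * B ks m                                  ∎
      where open ≡.≡-Reasoning

    b-snoc-pascal : ∀ k m → b (ks ∷ʳ suc (suc k)) (suc m) ≡ b (ks ∷ʳ suc (suc k)) m + b (ks ∷ʳ suc k) m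
    b-snoc-pascal k m = begin
      b k″ (suc m)
        ≡⟨ b≡coeffDiv⁺ k″≥1 (snoc-nonempty _) (sum-snoc-suc ks (suc k)) (suc m) ⟩
      coeffDiv⁺ (Ā k″) (suc K′) (suc m)
        ≡⟨ coeffDiv⁺-pascal (Ā k″) K′ m ⟩
      coeffDiv⁺ (Ā k″) (suc K′) m + coeffDiv⁺ (Ā k″) K′ (suc m)
        ≡⟨ cong (coeffDiv⁺ (Ā k″) (suc K′) m +_) (conv-suc′ (Ā k″) (λ a → C⁺ a K′) m) ⟩
      coeffDiv⁺ (Ā k″) (suc K′) m + (Ā k″ 0 * C⁺ (suc m) K′ + coeffDiv⁺ (Ā k″ ∘ suc) K′ m)
        ≡⟨ cong (λ x → coeffDiv⁺ (Ā k″) (suc K′) m + (x * C⁺ (suc m) K′ + coeffDiv⁺ (Ā k″ ∘ suc) K′ m))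
             (A-vanishes k″≥1 (s≤s (length≤sum k″≥1))) ⟩
      coeffDiv⁺ (Ā k″) (suc K′) m + coeffDiv⁺ (Ā k″ ∘ suc) K′ m
        ≡⟨ cong (coeffDiv⁺ (Ā k″) (suc K′) m +_) (coeffDiv⁺-congˡ K′ m (λ {i} _ → Ā-snoc-suc-last ks k i)) ⟩
      coeffDiv⁺ (Ā k″) (suc K′) m + coeffDiv⁺ (Ā k′) K′ m
        ≡⟨ cong₂ _+_ (sym (b≡coeffDiv⁺ k″≥1 (snoc-nonempty _) (sum-snoc-suc ks (suc k)) m))
                     (sym (b≡coeffDiv⁺ (snoc≥1 (s≤s z≤n)) (snoc-nonempty _) refl m)) ⟩
      b k″ m + b k′ m                                             ∎
      where
      open ≡.≡-Reasoning
      k′ k″ : List ℕ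
      k′ = ks ∷ʳ suc k
      k″ = ks ∷ʳ suc (suc k)
      K′ : ℕ
      K′ = sum k′
      k″≥1 : All (1 ≤_) k″
      k″≥1 = snoc≥1 (s≤s z≤n)

    B-snoc-conv : ∀ k m → B (ks ∷ʳ suc (suc k)) m ≡ coeffDiv⁺ (λ i → i * B ks i) k m
    B-snoc-conv k       zero    = B-snoc-zero (s≤s z≤n)
    B-snoc-conv zero    (suc m) = begin
      B (ks ∷ʳ 2) (suc m)                                   ≡⟨ B-snoc-pascal 0 m ⟩
      B (ks ∷ʳ 2) m + B (ks ∷ʳ 1) (suc m)                   ≡⟨ cong₂ _+_ (B-snoc-conv 0 m) (B-snoc-one (suc m)) ⟩
      coeffDiv⁺ f 0 m + suc m * B ks (suc m)
        ≡⟨ cong₂ _+_ (conv-congʳ f m (λ {a} _ → C⁺-zeroʳ a)) (sym (*-identityʳ _)) ⟩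
      conv f (λ a → C⁺ (suc a) 0) m + f (suc m) * 1         ≡⟨ sym (conv-suc f (λ a → C⁺ a 0) m) ⟩
      coeffDiv⁺ f 0 (suc m)                                 ∎
      where
      open ≡.≡-Reasoning
      f : ℕ → ℕ
      f i = i * B ks i
    B-snoc-conv (suc k) (suc m) = begin
      B (ks ∷ʳ suc (suc (suc k))) (suc m)                                 ≡⟨ B-snoc-pascal (suc k) m ⟩
      B (ks ∷ʳ suc (suc (suc k))) m + B (ks ∷ʳ suc (suc k)) (suc m)       ≡⟨ cong₂ _+_ (B-snoc-conv (suc k) m) (B-snoc-conv k (suc m)) ⟩
      coeffDiv⁺ f (suc k) m + coeffDiv⁺ f k (suc m)                       ≡⟨ sym (coeffDiv⁺-pascal f k m) ⟩
      coeffDiv⁺ f (suc k) (suc m)                                         ∎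
      where
      open ≡.≡-Reasoning
      f : ℕ → ℕ
      f i = i * B ks i

    b-snoc-conv : ∀ k m → b (ks ∷ʳ suc (suc k)) (suc m) ≡ conv (λ i → i * b ks i) (_C k) m
    b-snoc-conv k       zero    = trans (b-snoc-pascal k 0) (cong₂ _+_ (b-snoc-zero (s≤s z≤n)) (b-snoc-zero (s≤s z≤n)))
    b-snoc-conv zero    (suc m) = begin
      b (ks ∷ʳ 2) (suc (suc m))                       ≡⟨ b-snoc-pascal 0 (suc m) ⟩
      b (ks ∷ʳ 2) (suc m) + b (ks ∷ʳ 1) (suc m)       ≡⟨ cong₂ _+_ (b-snoc-conv 0 m) (b-snoc-one ks≥1 (suc m)) ⟩
      conv f (_C 0) m + suc m * b ks (suc m)          ≡⟨ cong (conv f (_C 0) m +_) (sym (*-identityʳ _)) ⟩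
      conv f (_C 0) m + f (suc m) * 1                 ≡⟨ sym (conv-suc f (_C 0) m) ⟩
      conv f (_C 0) (suc m)                           ∎
      where
      open ≡.≡-Reasoning
      f : ℕ → ℕ
      f i = i * b ks i
    b-snoc-conv (suc k) (suc m) = begin
      b (ks ∷ʳ suc (suc (suc k))) (suc (suc m))                           ≡⟨ b-snoc-pascal (suc k) (suc m) ⟩
      b (ks ∷ʳ suc (suc (suc k))) (suc m) + b (ks ∷ʳ suc (suc k)) (suc m) ≡⟨ cong₂ _+_ (b-snoc-conv (suc k) m) (b-snoc-conv k m) ⟩
      conv f (_C suc k) m + conv f (_C k) m                               ≡⟨ sym (conv-C-pascal f k m) ⟩
      conv f (_C suc k) (suc m)                                           ∎
      where
      open ≡.≡-Reasoning
      f : ℕ → ℕ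
      f i = i * b ks i

    B-snoc-sum : ∀ {kn} → 1 < kn → ∀ m → B (ks ∷ʳ kn) m ≡ sumTo m (λ i → i * B ks i * ((kn + m ∸ i ∸ 2) C (kn ∸ 2)))
    B-snoc-sum {suc (suc k)} (s≤s (s≤s z≤n)) m = trans (B-snoc-conv k m)
      (sumTo-cong m λ {i} i≤m → cong (i * B ks i *_) (trans (C⁺≡C (m ∸ i) k) (cong (_C k) (sym (index i≤m)))))
      where
      index : ∀ {i} → i ≤ m → suc (suc k) + m ∸ i ∸ 2 ≡ m ∸ i + k
      index i≤m = trans (cong (_∸ 2) (+-∸-assoc (suc (suc k)) i≤m)) (+-comm k _)

    b-snoc-sum : ∀ {kn} → 1 < kn → ∀ {m} → 1 ≤ m →
      b (ks ∷ʳ kn) m ≡ sumTo (m ∸ 1) (λ i → i * b ks i * ((m ∸ i ∸ 1) C (kn ∸ 2)))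
    b-snoc-sum {suc (suc k)} (s≤s (s≤s z≤n)) {suc m} _ = trans (b-snoc-conv k m)
      (sumTo-cong m λ {i} i≤m → cong (λ a → i * b ks i * (a C k)) (sym (cong (_∸ 1) (+-∸-assoc 1 i≤m))))

  sumTo-indicator-== : ∀ d {K} → d ≤ K → sumTo K (λ i → indicator (d == i)) ≡ 1
  sumTo-indicator-== d d≤K =
    trans (sumTo-≥ (λ i → indicator (d == i)) d≤K (λ d<i → cong indicator (≢⇒==-false (<⇒≢ d<i)))) (up-to d)
    where
    up-to : ∀ d → sumTo d (λ i → indicator (d == i)) ≡ 1
    up-to zero    = refl
    up-to (suc d) = trans (sumTo-suc d (λ i → indicator (suc d == i)))
      (cong₂ _+_ (sumTo-zero d (λ i≤d → cong indicator (≢⇒==-false (>⇒≢ (s≤s i≤d))))) (cong indicator (==-refl (suc d))))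

  sumTo-countᵇ-des : ∀ K ws → (∀ {w} → w ∈ ws → des w ≤ K) → sumTo K (λ i → countᵇ (λ w → des w == i) ws) ≡ length ws
  sumTo-countᵇ-des K []       _    = sumTo-zero K (λ _ → refl)
  sumTo-countᵇ-des K (w ∷ ws) des≤ = trans (sumTo-+ K (λ i → indicator (des w == i)) (λ i → countᵇ (λ w → des w == i) ws))
    (cong₂ _+_ (sumTo-indicator-== (des w) (des≤ (here refl))) (sumTo-countᵇ-des K ws (des≤ ∘ there)))

  sumTo-A : ∀ k → sumTo (sum k) (A k) ≡ length (SP k)
  sumTo-A k = sumTo-countᵇ-des (sum k) (SP k) λ {w} w∈ →
    ≤-trans (countᵇ-≤ _ (upTo (length w))) (≤-reflexive (trans (length-upTo (length w)) (proj₁ (∈-SP⁻ k w∈))))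

  sumTo-Ā : ∀ {k} → All (1 ≤_) k → 0 < sum k → sumTo (sum k) (Ā k) ≡ length (SP k)
  sumTo-Ā {k} k≥1 K>0 = begin
    sumTo K (Ā k)
      ≡⟨ sumTo-≥ (Ā k) (n≤1+n K) (λ K<i → trans (cong (A k) (m≤n⇒m∸n≡0 K<i)) (A-zero k K>0)) ⟨
    sumTo (suc K) (λ i → A k (suc K ∸ i))
      ≡⟨ sumTo-reverse (suc K) (A k) ⟩
    sumTo (suc K) (A k)
      ≡⟨ sumTo-≥ (A k) (n≤1+n K) (λ K<i → A-vanishes k≥1 (≤-<-trans (length≤sum k≥1) K<i)) ⟩
    sumTo K (A k)                                ≡⟨ sumTo-A k ⟩
    length (SP k)                                ∎
    where
    open ≡.≡-Reasoning
    K : ℕ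
    K = sum k

  SP-nonempty : ∀ {k} → All (1 ≤_) k → 1 ≤ length (SP k)
  SP-nonempty {k} = go (reverseView k)
    where
    go : ∀ {k} → Reverse k → All (1 ≤_) k → 1 ≤ length (SP k)
    go []             _   = s≤s z≤n
    go (ks ∶ r ∶ʳ kn) k≥1 with Allₚ.∷ʳ⁻ k≥1
    ... | ks≥1 , kn≥1 = subst (1 ≤_) (sym (length-SP-snoc ks kn kn≥1)) (*-mono-≤ {1} {suc (sum ks)} (s≤s z≤n) (go r ks≥1))

module Polynomials where

  open Combinatorics using (≤ᵇ-true; ≤ᵇ-false; coeffDiv⁺; C⁺; C⁺-absorb; C⁺-zeroʳ; sumTo-suc; sumTo-≥; sumTo-cong)
  open import Data.Bool.Base using (true; false; if_then_else_)
  import Data.Nat.Base as ℕ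
  open import Data.Nat.Base using (ℕ; zero; suc; _!; _∸_; z≤n; s≤s)
  import Data.Nat.Properties as ℕ
  open import Data.Nat.Properties using (_!≢0)
  open import Data.Integer.Base as ℤ using (+_)
  import Data.Integer.Properties as ℤ
  open import Data.Integer.GCD using (gcd)
  open import Data.Nat.Coprimality using (1-coprimeTo)
  import Data.Nat.Coprimality as Coprime
  open import Data.Rational.Base using (ℚ; _+_; _*_; -_; 0ℚ; 1ℚ; _/_; fromℚᵘ)
  open import Data.Rational.Properties
  import Data.Rational.Unnormalised.Base as ℚᵘ
  import Data.Rational.Unnormalised.Properties as ℚᵘ
  open import Data.Rational.Solver using (module +-*-Solver)
  open import Data.List.Base using (List; []; _∷_; _∷ʳ_; map; upTo)
  import Data.List.Properties as List
  open import Data.Product.Base using (_,_)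
  open import Function.Base using (_∘_)
  open import Relation.Binary.PropositionalEquality as ≡ using (_≡_; _≢_; refl; cong; cong₂; sym; trans)
  open import Relation.Nullary.Decidable using (yes; no)
  open +-*-Solver

  fromℕℚ-suc : ∀ n → fromℕℚ (suc n) ≡ 1ℚ + fromℕℚ n
  fromℕℚ-suc n rewrite normalize-coprime {n} {0} (Coprime.sym (1-coprimeTo n)) =
    sym (/-cong {p₁ = + 1 ℤ.* + 1 ℤ.+ + n ℤ.* + 1} {q₁ = 1} {p₂ = + suc n} {q₂ = 1}
           (cong (λ z → (+ 1) ℤ.+ z) (ℤ.*-identityʳ (+ n))) refl)

  fromℕℚ-+ : ∀ a b → fromℕℚ (a ℕ.+ b) ≡ fromℕℚ a + fromℕℚ b
  fromℕℚ-+ zero    b = sym (+-identityˡ (fromℕℚ b))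
  fromℕℚ-+ (suc a) b rewrite fromℕℚ-suc (a ℕ.+ b) | fromℕℚ-+ a b | fromℕℚ-suc a = sym (+-assoc 1ℚ (fromℕℚ a) (fromℕℚ b))

  fromℕℚ-* : ∀ a b → fromℕℚ (a ℕ.* b) ≡ fromℕℚ a * fromℕℚ b
  fromℕℚ-* zero    b = sym (*-zeroˡ (fromℕℚ b))
  fromℕℚ-* (suc a) b rewrite fromℕℚ-+ b (a ℕ.* b) | fromℕℚ-* a b | fromℕℚ-suc a =
    solve 2 (λ x y → y :+ x :* y := (con 1ℚ :+ x) :* y) refl (fromℕℚ a) (fromℕℚ b)

  fromℚᵘ-* : ∀ p r → fromℚᵘ p * fromℚᵘ r ≡ fromℚᵘ (p ℚᵘ.* r)
  fromℚᵘ-* p r = toℚᵘ-injective (ℚᵘ.≃-trans (toℚᵘ-homo-* (fromℚᵘ p) (fromℚᵘ r))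
    (ℚᵘ.≃-trans (ℚᵘ.*-cong (toℚᵘ-fromℚᵘ p) (toℚᵘ-fromℚᵘ r)) (ℚᵘ.≃-sym (toℚᵘ-fromℚᵘ (p ℚᵘ.* r)))))

  /-*-fromℕℚ : ∀ a b d .{{_ : ℕ.NonZero d}} → (+ a / d) * fromℕℚ b ≡ + (a ℕ.* b) / d
  /-*-fromℕℚ a b (suc d) = trans (fromℚᵘ-* (ℚᵘ.mkℚᵘ (+ a) d) (ℚᵘ.mkℚᵘ (+ b) 0))
    (/-cong {p₁ = + a ℤ.* + b} {q₁ = suc (d ℕ.* 1)} {p₂ = + (a ℕ.* b)} {q₂ = suc d}
       (sym (ℤ.pos-* a b)) (cong suc (ℕ.*-identityʳ d)))

  *-/-cancel : ∀ a d .{{_ : ℕ.NonZero d}} → + (a ℕ.* d) / d ≡ fromℕℚ a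
  *-/-cancel a (suc d) = fromℚᵘ-cong {ℚᵘ.mkℚᵘ (+ (a ℕ.* suc d)) d} {ℚᵘ.mkℚᵘ (+ a) 0}
    (ℚᵘ.*≡* (trans (ℤ.*-identityʳ _) (ℤ.pos-* a (suc d))))

  /-≢0 : ∀ a d .{{_ : ℕ.NonZero d}} → 1 ℕ.≤ a → + a / d ≢ 0ℚ
  /-≢0 a d 1≤a a/d≡0 = ℕ.<⇒≢ 1≤a (sym (ℤ.+-injective (begin
    + a                           ≡⟨ sym (↥-/ (+ a) d) ⟩
    ↥ (+ a / d) ℤ.* gcd (+ a) (+ d) ≡⟨ cong (ℤ._* gcd (+ a) (+ d)) (p≡0⇒↥p≡0 (+ a / d) a/d≡0) ⟩
    ℤ.0ℤ ℤ.* gcd (+ a) (+ d)       ≡⟨ ℤ.*-zeroˡ (gcd (+ a) (+ d)) ⟩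
    + 0                           ∎)))
    where
    open ≡.≡-Reasoning
    open import Data.Rational.Base using (↥_)

  signℚ-square : ∀ n → signℚ n * signℚ n ≡ 1ℚ
  signℚ-square zero    = refl
  signℚ-square (suc n) = trans (solve 1 (λ s → (:- s) :* (:- s) := s :* s) refl (signℚ n)) (signℚ-square n)

  sumQ : ℕ → (ℕ → ℚ) → ℚ
  sumQ zero    f = f 0
  sumQ (suc N) f = sumQ N f + f (suc N)

  sumQ-cong : ∀ N {f g} → (∀ {j} → j ℕ.≤ N → f j ≡ g j) → sumQ N f ≡ sumQ N g
  sumQ-cong zero    f≡g = f≡g z≤n
  sumQ-cong (suc N) f≡g = cong₂ _+_ (sumQ-cong N (f≡g ∘ ℕ.m≤n⇒m≤1+n)) (f≡g ℕ.≤-refl)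

  sumQ-fromℕℚ : ∀ N (f : ℕ → ℕ) → sumQ N (fromℕℚ ∘ f) ≡ fromℕℚ (sumTo N f)
  sumQ-fromℕℚ zero    f = cong fromℕℚ (sym (ℕ.+-identityʳ (f 0)))
  sumQ-fromℕℚ (suc N) f = trans (cong (_+ fromℕℚ (f (suc N))) (sumQ-fromℕℚ N f))
    (trans (sym (fromℕℚ-+ (sumTo N f) (f (suc N)))) (cong fromℕℚ (sym (sumTo-suc N f))))

  sumQ-*ʳ : ∀ N c f → sumQ N (λ j → f j * c) ≡ sumQ N f * c
  sumQ-*ʳ zero    c f = refl
  sumQ-*ʳ (suc N) c f = trans (cong (_+ f (suc N) * c) (sumQ-*ʳ N c f)) (sym (*-distribʳ-+ c (sumQ N f) (f (suc N))))

  sumQ-*ˡ : ∀ N c f → sumQ N (λ j → c * f j) ≡ c * sumQ N f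
  sumQ-*ˡ zero    c f = refl
  sumQ-*ˡ (suc N) c f = trans (cong (_+ c * f (suc N)) (sumQ-*ˡ N c f)) (sym (*-distribˡ-+ c (sumQ N f) (f (suc N))))

  sumQ-0 : ∀ N → sumQ N (λ _ → 0ℚ) ≡ 0ℚ
  sumQ-0 zero    = refl
  sumQ-0 (suc N) = trans (+-identityʳ (sumQ N (λ _ → 0ℚ))) (sumQ-0 N)

  sumQ-suc-0 : ∀ N f → f (suc N) ≡ 0ℚ → sumQ (suc N) f ≡ sumQ N f
  sumQ-suc-0 N f fN+1≡0 = trans (cong (λ v → sumQ N f + v) fN+1≡0) (+-identityʳ (sumQ N f))

  sumQ-suc′ : ∀ N f → sumQ (suc N) f ≡ f 0 + sumQ N (f ∘ suc)
  sumQ-suc′ zero    f = refl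
  sumQ-suc′ (suc N) f = trans (cong (_+ f (suc (suc N))) (sumQ-suc′ N f)) (+-assoc (f 0) _ _)

  sumQ-reverse : ∀ N f → sumQ N (λ j → f (N ∸ j)) ≡ sumQ N f
  sumQ-reverse zero    f = refl
  sumQ-reverse (suc N) f = trans (sumQ-suc′ N (λ j → f (suc N ∸ j)))
    (trans (cong (λ s → f (suc N) + s) (sumQ-reverse N f)) (+-comm (f (suc N)) (sumQ N f)))

  horner : ℕ → (ℕ → ℚ) → ℚ → ℚ
  horner zero    f x = 0ℚ
  horner (suc n) f x = f 0 + x * horner n (f ∘ suc) x

  evalPoly-map-upTo : ∀ n f x → evalPoly (map f (upTo n)) x ≡ horner n f x
  evalPoly-map-upTo zero    f x = refl
  evalPoly-map-upTo (suc n) f x = cong (λ v → f 0 + x * v)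
    (trans (cong (λ cs → evalPoly cs x) (trans (List.map-applyUpTo suc f n) (sym (List.map-upTo (f ∘ suc) n))))
      (evalPoly-map-upTo n (f ∘ suc) x))

  horner-cong : ∀ n {f g} x → (∀ i → f i ≡ g i) → horner n f x ≡ horner n g x
  horner-cong zero    x f≡g = refl
  horner-cong (suc n) x f≡g = cong₂ (λ a v → a + x * v) (f≡g 0) (horner-cong n x (f≡g ∘ suc))

  horner-+ : ∀ n f g x → horner n (λ i → f i + g i) x ≡ horner n f x + horner n g x
  horner-+ zero    f g x = sym (+-identityˡ 0ℚ)
  horner-+ (suc n) f g x rewrite horner-+ n (f ∘ suc) (g ∘ suc) x =
    solve 5 (λ a b x u v → a :+ b :+ x :* (u :+ v) := a :+ x :* u :+ (b :+ x :* v)) refl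
      (f 0) (g 0) x (horner n (f ∘ suc) x) (horner n (g ∘ suc) x)

  horner-*ˡ : ∀ n c f x → horner n (λ i → c * f i) x ≡ c * horner n f x
  horner-*ˡ zero    c f x = sym (*-zeroʳ c)
  horner-*ˡ (suc n) c f x rewrite horner-*ˡ n c (f ∘ suc) x =
    solve 4 (λ c a x u → c :* a :+ x :* (c :* u) := c :* (a :+ x :* u)) refl c (f 0) x (horner n (f ∘ suc) x)

  horner-top-0 : ∀ n f x → f n ≡ 0ℚ → horner (suc n) f x ≡ horner n f x
  horner-top-0 zero    f x fn≡0 rewrite fn≡0 = solve 1 (λ x → con 0ℚ :+ x :* con 0ℚ := con 0ℚ) refl x
  horner-top-0 (suc n) f x fn≡0 = cong (λ v → f 0 + x * v) (horner-top-0 n (f ∘ suc) x fn≡0)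

  horner-sumQ : ∀ n N (F : ℕ → ℕ → ℚ) x → horner n (λ i → sumQ N (λ j → F j i)) x ≡ sumQ N (λ j → horner n (F j) x)
  horner-sumQ n zero    F x = refl
  horner-sumQ n (suc N) F x =
    trans (horner-+ n (λ i → sumQ N (λ j → F j i)) (F (suc N)) x) (cong (_+ horner n (F (suc N)) x) (horner-sumQ n N F x))

  rising : ℕ → ℚ → ℚ
  rising zero    y = 1ℚ
  rising (suc K) y = (y + fromℕℚ (suc K)) * rising K y

  shiftCoeff : (ℕ → ℚ) → ℕ → ℚ
  shiftCoeff f zero    = 0ℚ
  shiftCoeff f (suc i) = f i

  risingCoeff : ℕ → ℚ → ℕ → ℚ
  risingCoeff zero    c zero    = 1ℚ
  risingCoeff zero    c (suc i) = 0ℚ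
  risingCoeff (suc K) c i       = (c + fromℕℚ (suc K)) * risingCoeff K c i + shiftCoeff (risingCoeff K c) i

  risingCoeff-high : ∀ K c {i} → K ℕ.< i → risingCoeff K c i ≡ 0ℚ
  risingCoeff-high zero    c {suc i} _ = refl
  risingCoeff-high (suc K) c {suc i} (s≤s K<i)
    rewrite risingCoeff-high K c (ℕ.m≤n⇒m≤1+n K<i) | risingCoeff-high K c K<i =
    solve 1 (λ a → a :* con 0ℚ :+ con 0ℚ := con 0ℚ) refl (c + fromℕℚ (suc K))

  risingCoeff-top : ∀ K c → risingCoeff K c K ≡ 1ℚ
  risingCoeff-top zero    c = refl
  risingCoeff-top (suc K) c rewrite risingCoeff-high K c (ℕ.n<1+n K) | risingCoeff-top K c =
    solve 1 (λ a → a :* con 0ℚ :+ con 1ℚ := con 1ℚ) refl (c + fromℕℚ (suc K))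

  horner-risingCoeff : ∀ K c x → horner (suc K) (risingCoeff K c) x ≡ rising K (x + c)
  horner-risingCoeff zero    c x = solve 1 (λ x → con 1ℚ :+ x :* con 0ℚ := con 1ℚ) refl x
  horner-risingCoeff (suc K) c x = begin
    horner (suc (suc K)) (λ i → a * risingCoeff K c i + shiftCoeff (risingCoeff K c) i) x
      ≡⟨ horner-+ (suc (suc K)) (λ i → a * risingCoeff K c i) (shiftCoeff (risingCoeff K c)) x ⟩
    horner (suc (suc K)) (λ i → a * risingCoeff K c i) x + (0ℚ + x * E)
      ≡⟨ cong (_+ (0ℚ + x * E)) (trans (horner-*ˡ (suc (suc K)) a (risingCoeff K c) x)
           (cong (a *_) (horner-top-0 (suc K) (risingCoeff K c) x (risingCoeff-high K c (ℕ.n<1+n K))))) ⟩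
    a * E + (0ℚ + x * E)
      ≡⟨ solve 4 (λ c k x E → (c :+ k) :* E :+ (con 0ℚ :+ x :* E) := (x :+ c :+ k) :* E) refl c (fromℕℚ (suc K)) x E ⟩
    (x + c + fromℕℚ (suc K)) * E
      ≡⟨ cong ((x + c + fromℕℚ (suc K)) *_) (horner-risingCoeff K c x) ⟩
    rising (suc K) (x + c) ∎
    where
    open ≡.≡-Reasoning
    a E : ℚ
    a = c + fromℕℚ (suc K)
    E = horner (suc K) (risingCoeff K c) x

  rising-fromℕℚ : ∀ K a → rising K (fromℕℚ a) ≡ fromℕℚ (C⁺ a K ℕ.* K !)
  rising-fromℕℚ zero    a = cong fromℕℚ (sym (trans (ℕ.*-identityʳ (C⁺ a 0)) (C⁺-zeroʳ a)))
  rising-fromℕℚ (suc K) a = begin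
    (fromℕℚ a + fromℕℚ (suc K)) * rising K (fromℕℚ a)  ≡⟨ cong₂ _*_ (sym (fromℕℚ-+ a (suc K))) (rising-fromℕℚ K a) ⟩
    fromℕℚ (a ℕ.+ suc K) * fromℕℚ (C⁺ a K ℕ.* K !)      ≡⟨ sym (fromℕℚ-* (a ℕ.+ suc K) _) ⟩
    fromℕℚ ((a ℕ.+ suc K) ℕ.* (C⁺ a K ℕ.* K !))         ≡⟨ cong fromℕℚ step ⟩
    fromℕℚ (C⁺ a (suc K) ℕ.* (suc K) !)                 ∎
    where
    open ≡.≡-Reasoning
    step : (a ℕ.+ suc K) ℕ.* (C⁺ a K ℕ.* K !) ≡ C⁺ a (suc K) ℕ.* (suc K) !
    step = begin
      (a ℕ.+ suc K) ℕ.* (C⁺ a K ℕ.* K !)  ≡⟨ cong (ℕ._* (C⁺ a K ℕ.* K !)) (ℕ.+-suc a K) ⟩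
      suc (a ℕ.+ K) ℕ.* (C⁺ a K ℕ.* K !)  ≡⟨ sym (ℕ.*-assoc (suc (a ℕ.+ K)) (C⁺ a K) (K !)) ⟩
      suc (a ℕ.+ K) ℕ.* C⁺ a K ℕ.* K !    ≡⟨ cong (ℕ._* K !) (sym (C⁺-absorb a K)) ⟩
      suc K ℕ.* C⁺ a (suc K) ℕ.* K !      ≡⟨ ℕ.*-assoc (suc K) (C⁺ a (suc K)) (K !) ⟩
      suc K ℕ.* (C⁺ a (suc K) ℕ.* K !)    ≡⟨ cong (suc K ℕ.*_) (ℕ.*-comm (C⁺ a (suc K)) (K !)) ⟩
      suc K ℕ.* (K ! ℕ.* C⁺ a (suc K))    ≡⟨ sym (ℕ.*-assoc (suc K) (K !) (C⁺ a (suc K))) ⟩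
      (suc K) ! ℕ.* C⁺ a (suc K)          ≡⟨ ℕ.*-comm ((suc K) !) (C⁺ a (suc K)) ⟩
      C⁺ a (suc K) ℕ.* (suc K) !          ∎

  rising-root : ∀ K {r} → 1 ℕ.≤ r → r ℕ.≤ K → rising K (- fromℕℚ r) ≡ 0ℚ
  rising-root zero    {suc r} _ ()
  rising-root (suc K) {r} 1≤r r≤K+1 with r ℕ.≟ suc K
  ... | yes refl = trans (cong (_* rising K (- fromℕℚ (suc K))) (+-inverseˡ (fromℕℚ (suc K)))) (*-zeroˡ (rising K (- fromℕℚ (suc K))))
  ... | no  r≢K+1 = trans (cong ((- fromℕℚ r + fromℕℚ (suc K)) *_) (rising-root K 1≤r (ℕ.≤-pred (ℕ.≤∧≢⇒< r≤K+1 r≢K+1))))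
                          (*-zeroʳ (- fromℕℚ r + fromℕℚ (suc K)))

  rising-suc : ∀ K y → rising (suc K) y ≡ (y + 1ℚ) * rising K (y + 1ℚ)
  rising-suc zero    y = solve 1 (λ y → (y :+ con 1ℚ) :* con 1ℚ := (y :+ con 1ℚ) :* con 1ℚ) refl y
  rising-suc (suc K) y = begin
    (y + fromℕℚ (suc (suc K))) * rising (suc K) y
      ≡⟨ cong₂ (λ a r → (y + a) * r) (fromℕℚ-suc (suc K)) (rising-suc K y) ⟩
    (y + (1ℚ + fromℕℚ (suc K))) * ((y + 1ℚ) * rising K (y + 1ℚ))
      ≡⟨ solve 3 (λ y k R → (y :+ (con 1ℚ :+ k)) :* ((y :+ con 1ℚ) :* R) := (y :+ con 1ℚ) :* ((y :+ con 1ℚ :+ k) :* R)) refl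
           y (fromℕℚ (suc K)) (rising K (y + 1ℚ)) ⟩
    (y + 1ℚ) * ((y + 1ℚ + fromℕℚ (suc K)) * rising K (y + 1ℚ)) ∎
    where open ≡.≡-Reasoning

  -- The factors y + t of rising K y and the factors -y - (K + 1) + t of the reflected one match up as t ↔ K + 1 - t.
  rising-reflect : ∀ K y → rising K (- y + - fromℕℚ (suc K)) ≡ signℚ K * rising K y
  rising-reflect zero    y = refl
  rising-reflect (suc K) y = begin
    (- y + - fromℕℚ (suc (suc K)) + k) * rising K (- y + - fromℕℚ (suc (suc K)))
      ≡⟨ cong₂ (λ a b → a * rising K b) first-factor argument ⟩
    (- (y + 1ℚ)) * rising K (- (y + 1ℚ) + - k)
      ≡⟨ cong ((- (y + 1ℚ)) *_) (rising-reflect K (y + 1ℚ)) ⟩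
    (- (y + 1ℚ)) * (signℚ K * rising K (y + 1ℚ))
      ≡⟨ solve 3 (λ y s R → (:- (y :+ con 1ℚ)) :* (s :* R) := (:- s) :* ((y :+ con 1ℚ) :* R)) refl y (signℚ K) (rising K (y + 1ℚ)) ⟩
    (- signℚ K) * ((y + 1ℚ) * rising K (y + 1ℚ))
      ≡⟨ cong ((- signℚ K) *_) (sym (rising-suc K y)) ⟩
    signℚ (suc K) * rising (suc K) y ∎
    where
    open ≡.≡-Reasoning
    k : ℚ
    k = fromℕℚ (suc K)
    first-factor : - y + - fromℕℚ (suc (suc K)) + k ≡ - (y + 1ℚ)
    first-factor = trans (cong (λ z → - y + - z + k) (fromℕℚ-suc (suc K)))
      (solve 2 (λ y k → :- y :+ (:- (con 1ℚ :+ k)) :+ k := :- (y :+ con 1ℚ)) refl y k)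
    argument : - y + - fromℕℚ (suc (suc K)) ≡ - (y + 1ℚ) + - k
    argument = trans (cong (λ z → - y + - z) (fromℕℚ-suc (suc K)))
      (solve 2 (λ y k → :- y :+ (:- (con 1ℚ :+ k)) := :- (y :+ con 1ℚ) :+ (:- k)) refl y k)

  module _ (K : ℕ) where

    private
      instance
        K!≢0 : ℕ.NonZero (K !)
        K!≢0 = K !≢0

      1/K! : ℚ
      1/K! = + 1 / K !

      weight : ℕ → ℚ
      weight a = fromℕℚ a * 1/K!

      weight-zero : ∀ {a} y → a ≡ 0 → weight a * y ≡ 0ℚ
      weight-zero y refl = trans (cong (_* y) (*-zeroˡ 1/K!)) (*-zeroˡ y)

    interpolantCoeff : (ℕ → ℕ) → ℕ → ℚ
    interpolantCoeff c i = sumQ K (λ j → weight (c j) * risingCoeff K (- fromℕℚ j) i)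

    -- Σⱼ c j (x - j + 1) ⋯ (x - j + K) / K!, whose values at natural numbers are the coefficients of c(x) (1 - x)^-(K+1).
    interpolant : (ℕ → ℕ) → List ℚ
    interpolant c = map (interpolantCoeff c) (upTo (suc K))

    eval-interpolant : ∀ c x → evalPoly (interpolant c) x ≡ sumQ K (λ j → weight (c j) * rising K (x + - fromℕℚ j))
    eval-interpolant c x = begin
      evalPoly (interpolant c) x
        ≡⟨ evalPoly-map-upTo (suc K) (interpolantCoeff c) x ⟩
      horner (suc K) (interpolantCoeff c) x
        ≡⟨ horner-sumQ (suc K) K (λ j i → weight (c j) * risingCoeff K (- fromℕℚ j) i) x ⟩
      sumQ K (λ j → horner (suc K) (λ i → weight (c j) * risingCoeff K (- fromℕℚ j) i) x)
        ≡⟨ sumQ-cong K (λ {j} _ → trans (horner-*ˡ (suc K) (weight (c j)) (risingCoeff K (- fromℕℚ j)) x)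
                                        (cong (weight (c j) *_) (horner-risingCoeff K (- fromℕℚ j) x))) ⟩
      sumQ K (λ j → weight (c j) * rising K (x + - fromℕℚ j)) ∎
      where open ≡.≡-Reasoning

    1/K!-*-fromℕℚ : ∀ a → 1/K! * fromℕℚ a ≡ + a / K !
    1/K!-*-fromℕℚ a = trans (/-*-fromℕℚ 1 a (K !)) (cong (λ n → + n / K !) (ℕ.*-identityˡ a))

    weight-rising-fromℕℚ : ∀ a b → weight a * rising K (fromℕℚ b) ≡ fromℕℚ (a ℕ.* C⁺ b K)
    weight-rising-fromℕℚ a b = begin
      fromℕℚ a * 1/K! * rising K (fromℕℚ b)          ≡⟨ cong (fromℕℚ a * 1/K! *_) (rising-fromℕℚ K b) ⟩
      fromℕℚ a * 1/K! * fromℕℚ (C⁺ b K ℕ.* K !)      ≡⟨ *-assoc (fromℕℚ a) 1/K! _ ⟩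
      fromℕℚ a * (1/K! * fromℕℚ (C⁺ b K ℕ.* K !))
        ≡⟨ cong (fromℕℚ a *_) (trans (1/K!-*-fromℕℚ (C⁺ b K ℕ.* K !)) (*-/-cancel (C⁺ b K) (K !))) ⟩
      fromℕℚ a * fromℕℚ (C⁺ b K)                      ≡⟨ sym (fromℕℚ-* a (C⁺ b K)) ⟩
      fromℕℚ (a ℕ.* C⁺ b K)                           ∎
      where open ≡.≡-Reasoning

    -- The j-th summand at x = m is c j · C⁺ (m - j) K if j ≤ m, and vanishes otherwise since then m - j is a root.
    summand-fromℕℚ : ∀ a {j} m → j ℕ.≤ K →
      weight a * rising K (fromℕℚ m + - fromℕℚ j) ≡ fromℕℚ (if j ℕ.≤ᵇ m then a ℕ.* C⁺ (m ∸ j) K else 0)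
    summand-fromℕℚ a {j} m j≤K with j ℕ.≤? m
    ... | yes j≤m rewrite ≤ᵇ-true j≤m = trans (cong (λ y → weight a * rising K y) m-j) (weight-rising-fromℕℚ a (m ∸ j))
      where
      m-j : fromℕℚ m + - fromℕℚ j ≡ fromℕℚ (m ∸ j)
      m-j = trans (cong (λ n → fromℕℚ n + - fromℕℚ j) (sym (ℕ.m∸n+n≡m j≤m)))
        (trans (cong (_+ - fromℕℚ j) (fromℕℚ-+ (m ∸ j) j))
          (solve 2 (λ x y → x :+ y :+ (:- y) := x) refl (fromℕℚ (m ∸ j)) (fromℕℚ j)))
    ... | no  j≰m rewrite ≤ᵇ-false j≰m = trans (cong (λ y → weight a * rising K y) m-j)
        (trans (cong (weight a *_) (rising-root K (ℕ.m<n⇒0<n∸m (ℕ.≰⇒> j≰m)) (ℕ.≤-trans (ℕ.m∸n≤m j m) j≤K)))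
          (*-zeroʳ (weight a)))
      where
      m-j : fromℕℚ m + - fromℕℚ j ≡ - fromℕℚ (j ∸ m)
      m-j = trans (cong (λ n → fromℕℚ m + - fromℕℚ n) (sym (ℕ.m∸n+n≡m (ℕ.<⇒≤ (ℕ.≰⇒> j≰m)))))
        (trans (cong (λ z → fromℕℚ m + - z) (fromℕℚ-+ (j ∸ m) m))
          (solve 2 (λ x y → y :+ (:- (x :+ y)) := :- x) refl (fromℕℚ (j ∸ m)) (fromℕℚ m)))

    interpolant-fromℕℚ : ∀ c → (∀ {j} → K ℕ.< j → c j ≡ 0) → ∀ m →
      evalPoly (interpolant c) (fromℕℚ m) ≡ fromℕℚ (coeffDiv⁺ c K m)
    interpolant-fromℕℚ c c-vanish m = begin
      evalPoly (interpolant c) (fromℕℚ m)                          ≡⟨ eval-interpolant c (fromℕℚ m) ⟩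
      sumQ K (λ j → weight (c j) * rising K (fromℕℚ m + - fromℕℚ j)) ≡⟨ sumQ-cong K (summand-fromℕℚ (c _) m) ⟩
      sumQ K (fromℕℚ ∘ t)                                          ≡⟨ sumQ-fromℕℚ K t ⟩
      fromℕℚ (sumTo K t)                                           ≡⟨ cong fromℕℚ (sumTo-≥ t (ℕ.m≤m+n K m) t-vanishes-K) ⟨
      fromℕℚ (sumTo (K ℕ.+ m) t)                                   ≡⟨ cong fromℕℚ (sumTo-≥ t (ℕ.m≤n+m m K) t-vanishes-m) ⟩
      fromℕℚ (sumTo m t)
        ≡⟨ cong fromℕℚ (sumTo-cong m λ {j} j≤m → cong (λ b → if b then c j ℕ.* C⁺ (m ∸ j) K else 0) (≤ᵇ-true j≤m)) ⟩
      fromℕℚ (coeffDiv⁺ c K m)                             ∎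
      where
      open ≡.≡-Reasoning
      t : ℕ → ℕ
      t j = if j ℕ.≤ᵇ m then c j ℕ.* C⁺ (m ∸ j) K else 0
      t-vanishes-K : ∀ {j} → K ℕ.< j → t j ≡ 0
      t-vanishes-K {j} K<j with j ℕ.≤ᵇ m
      ... | true  = cong (ℕ._* C⁺ (m ∸ j) K) (c-vanish K<j)
      ... | false = refl
      t-vanishes-m : ∀ {j} → m ℕ.< j → t j ≡ 0
      t-vanishes-m m<j rewrite ≤ᵇ-false (ℕ.<⇒≱ m<j) = refl

    interpolant-lead : ∀ c → interpolantCoeff c K ≡ + sumTo K c / K !
    interpolant-lead c = begin
      sumQ K (λ j → weight (c j) * risingCoeff K (- fromℕℚ j) K)
        ≡⟨ sumQ-cong K (λ {j} _ → trans (cong (weight (c j) *_) (risingCoeff-top K (- fromℕℚ j))) (*-identityʳ (weight (c j)))) ⟩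
      sumQ K (λ j → fromℕℚ (c j) * 1/K!)   ≡⟨ sumQ-*ʳ K 1/K! (fromℕℚ ∘ c) ⟩
      sumQ K (fromℕℚ ∘ c) * 1/K!           ≡⟨ cong (_* 1/K!) (sumQ-fromℕℚ K c) ⟩
      fromℕℚ (sumTo K c) * 1/K!            ≡⟨ *-comm (fromℕℚ (sumTo K c)) 1/K! ⟩
      1/K! * fromℕℚ (sumTo K c)            ≡⟨ 1/K!-*-fromℕℚ (sumTo K c) ⟩
      + sumTo K c / K !                    ∎
      where open ≡.≡-Reasoning

    interpolant-shape : ∀ c {L} → sumTo K c ≡ L → 1 ℕ.≤ L → IsPolyDegLead K (+ L / K !) (interpolant c)
    interpolant-shape c refl 1≤L =
      map (interpolantCoeff c) (upTo K) , P≡ , trans (List.length-map _ (upTo K)) (List.length-upTo K) , /-≢0 _ (K !) 1≤L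
      where
      P≡ : interpolant c ≡ map (interpolantCoeff c) (upTo K) ∷ʳ + sumTo K c / K !
      P≡ = trans (cong (map (interpolantCoeff c)) (sym (List.upTo-∷ʳ K)))
        (trans (List.map-++ (interpolantCoeff c) (upTo K) (K ∷ []))
          (cong (λ a → map (interpolantCoeff c) (upTo K) ∷ʳ a) (interpolant-lead c)))

    -- With c supported on 1, …, n, every summand has a factor vanishing at -r for r ≤ K - n.
    interpolant-root : ∀ c n → c 0 ≡ 0 → (∀ {j} → n ℕ.< j → c j ≡ 0) → ∀ {r} → r ℕ.+ n ℕ.≤ K →
      evalPoly (interpolant c) (- fromℕℚ r) ≡ 0ℚ
    interpolant-root c n c0≡0 c-vanish {r} r+n≤K =
      trans (eval-interpolant c (- fromℕℚ r)) (trans (sumQ-cong K summand≡0) (sumQ-0 K))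
      where
      summand≡0 : ∀ {j} → j ℕ.≤ K → weight (c j) * rising K (- fromℕℚ r + - fromℕℚ j) ≡ 0ℚ
      summand≡0 {zero}  _ = weight-zero _ c0≡0
      summand≡0 {suc j} _ with suc j ℕ.≤? n
      ... | no  j≰n = weight-zero _ (c-vanish (ℕ.≰⇒> j≰n))
      ... | yes j≤n = trans (cong (λ y → weight (c (suc j)) * rising K y) -r-j)
          (trans (cong (weight (c (suc j)) *_) (rising-root K (ℕ.≤-trans (s≤s z≤n) (ℕ.m≤n+m (suc j) r)) r+j+1≤K))
                 (*-zeroʳ (weight (c (suc j)))))
        where
        -r-j : - fromℕℚ r + - fromℕℚ (suc j) ≡ - fromℕℚ (r ℕ.+ suc j)
        -r-j = trans (solve 2 (λ x y → :- x :+ (:- y) := :- (x :+ y)) refl (fromℕℚ r) (fromℕℚ (suc j)))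
          (cong -_ (sym (fromℕℚ-+ r (suc j))))
        r+j+1≤K : r ℕ.+ suc j ℕ.≤ K
        r+j+1≤K = ℕ.≤-trans (ℕ.+-monoʳ-≤ r j≤n) r+n≤K

    -- Reindexing j ↦ K + 1 - j turns the factors of the j-th summand into those of rising-reflect.
    interpolant-reflect : ∀ c → c 0 ≡ 0 → c (suc K) ≡ 0 → ∀ x →
      evalPoly (interpolant (λ i → c (suc K ∸ i))) (- x) ≡ signℚ K * evalPoly (interpolant c) x
    interpolant-reflect c c0≡0 cK+1≡0 x = begin
      evalPoly (interpolant (λ i → c (suc K ∸ i))) (- x)
        ≡⟨ eval-interpolant (λ i → c (suc K ∸ i)) (- x) ⟩
      sumQ K F
        ≡⟨ sym (sumQ-suc-0 K F (weight-zero _ (trans (cong c (ℕ.n∸n≡0 K)) c0≡0))) ⟩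
      sumQ (suc K) F
        ≡⟨ sym (sumQ-reverse (suc K) F) ⟩
      sumQ (suc K) (λ j → F (suc K ∸ j))
        ≡⟨ sumQ-cong (suc K) reflected-summand ⟩
      sumQ (suc K) (λ j → signℚ K * G j)
        ≡⟨ sumQ-*ˡ (suc K) (signℚ K) G ⟩
      signℚ K * sumQ (suc K) G
        ≡⟨ cong (signℚ K *_) (sumQ-suc-0 K G (weight-zero _ cK+1≡0)) ⟩
      signℚ K * sumQ K G
        ≡⟨ cong (signℚ K *_) (sym (eval-interpolant c x)) ⟩
      signℚ K * evalPoly (interpolant c) x ∎
      where
      open ≡.≡-Reasoning
      F G : ℕ → ℚ
      F i = weight (c (suc K ∸ i)) * rising K (- x + - fromℕℚ i)
      G j = weight (c j) * rising K (x + - fromℕℚ j)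
      reflected-summand : ∀ {j} → j ℕ.≤ suc K → F (suc K ∸ j) ≡ signℚ K * G j
      reflected-summand {j} j≤K+1 = begin
        weight (c (suc K ∸ (suc K ∸ j))) * rising K (- x + - fromℕℚ (suc K ∸ j))
          ≡⟨ cong₂ (λ i y → weight (c i) * rising K y) (ℕ.m∸[m∸n]≡n j≤K+1) argument ⟩
        weight (c j) * rising K (- (x + - fromℕℚ j) + - fromℕℚ (suc K))
          ≡⟨ cong (weight (c j) *_) (rising-reflect K (x + - fromℕℚ j)) ⟩
        weight (c j) * (signℚ K * rising K (x + - fromℕℚ j))
          ≡⟨ solve 3 (λ w s R → w :* (s :* R) := s :* (w :* R)) refl (weight (c j)) (signℚ K) (rising K (x + - fromℕℚ j)) ⟩
        signℚ K * G j ∎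
        where
        argument : - x + - fromℕℚ (suc K ∸ j) ≡ - (x + - fromℕℚ j) + - fromℕℚ (suc K)
        argument = trans (solve 3 (λ x a b → :- x :+ (:- a) := :- (x :+ (:- b)) :+ (:- (a :+ b))) refl x (fromℕℚ (suc K ∸ j)) (fromℕℚ j))
          (cong (λ y → - (x + - fromℕℚ j) + - y) (trans (sym (fromℕℚ-+ (suc K ∸ j) j)) (cong fromℕℚ (ℕ.m∸n+n≡m j≤K+1))))

open Combinatorics
open Polynomials
open import Data.Nat.Base using (ℕ; suc; _+_; _*_; _∸_; _≤_; _<_; s≤s; z≤n)
open import Data.Nat.Properties using (≤-trans; ≤-reflexive; m∸n+n≡m; +-monoˡ-≤; m≤n⇒m∸n≡0; n<1+n; ≤-<-trans)
open import Data.Nat.Combinatorics using (_C_)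
open import Data.Nat.ListAction using (sum)
open import Data.List.Base using (List; []; _∷ʳ_; length)
open import Data.List.Relation.Unary.All using (All)
open import Data.Product.Base using (Σ; _×_; _,_)
open import Data.Rational.Base using (ℚ; -_; 0ℚ; 1ℚ) renaming (_*_ to _*ℚ_)
open import Data.Rational.Properties using (*-assoc; *-identityˡ)
open import Relation.Binary.PropositionalEquality as ≡ using (_≡_; refl; cong; sym; trans; subst)
import Data.List.Relation.Unary.All.Properties as Allₚ

polynomiality : ∀ {k} → All (1 ≤_) k → 0 < length k →
  Σ (List ℚ) λ P → Σ (List ℚ) λ Q →
      IsPolyDegLead (sum k) (leadCoeff k) P
    × IsPolyDegLead (sum k) (leadCoeff k) Q
    × (∀ m → evalPoly P (fromℕℚ m) ≡ fromℕℚ (B k m))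
    × (∀ m → evalPoly Q (fromℕℚ m) ≡ fromℕℚ (b k m))
    × (∀ j → j ≤ sum k ∸ length k → evalPoly P (- fromℕℚ j) ≡ 0ℚ)
    × (∀ x → evalPoly P x ≡ signℚ (sum k) *ℚ evalPoly Q (- x))
polynomiality {k} k≥1 n>0 =
    interpolant K (A k) , interpolant K (Ā k)
  , interpolant-shape K (A k) (sumTo-A k) (SP-nonempty k≥1)
  , interpolant-shape K (Ā k) (sumTo-Ā k≥1 K>0) (SP-nonempty k≥1)
  , (λ m → trans (interpolant-fromℕℚ K (A k) A-beyond-K m) (cong fromℕℚ (sym (B≡coeffDiv⁺ k≥1 refl m))))
  , (λ m → trans (interpolant-fromℕℚ K (Ā k) Ā-beyond-K m) (cong fromℕℚ (sym (b≡coeffDiv⁺ k≥1 n>0 refl m))))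
  , (λ j j≤K-n → interpolant-root K (A k) (length k) (A-zero k K>0) (A-vanishes k≥1)
                   (≤-trans (+-monoˡ-≤ (length k) j≤K-n) (≤-reflexive (m∸n+n≡m (length≤sum k≥1)))))
  , reciprocity
  where
  K : ℕ
  K = sum k
  K>0 : 0 < K
  K>0 = ≤-trans n>0 (length≤sum k≥1)
  A-beyond-K : ∀ {j} → K < j → A k j ≡ 0
  A-beyond-K K<j = A-vanishes k≥1 (≤-<-trans (length≤sum k≥1) K<j)
  Ā-beyond-K : ∀ {j} → K < j → Ā k j ≡ 0
  Ā-beyond-K K<j = trans (cong (A k) (m≤n⇒m∸n≡0 K<j)) (A-zero k K>0)
  reciprocity : ∀ x → evalPoly (interpolant K (A k)) x ≡ signℚ K *ℚ evalPoly (interpolant K (Ā k)) (- x)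
  reciprocity x = sym (begin
    signℚ K *ℚ evalPoly (interpolant K (Ā k)) (- x)
      ≡⟨ cong (signℚ K *ℚ_) (interpolant-reflect K (A k) (A-zero k K>0) (A-beyond-K (n<1+n K)) x) ⟩
    signℚ K *ℚ (signℚ K *ℚ evalPoly (interpolant K (A k)) x)       ≡⟨ sym (*-assoc (signℚ K) (signℚ K) _) ⟩
    signℚ K *ℚ signℚ K *ℚ evalPoly (interpolant K (A k)) x         ≡⟨ cong (_*ℚ evalPoly (interpolant K (A k)) x) (signℚ-square K) ⟩
    1ℚ *ℚ evalPoly (interpolant K (A k)) x                         ≡⟨ *-identityˡ _ ⟩
    evalPoly (interpolant K (A k)) x                               ∎)
    where open ≡.≡-Reasoning

theorem1 : (ks : List ℕ) (kn : ℕ) → All (1 ≤_) ks → 1 ≤ kn →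
    (Σ (List ℚ) λ P → Σ (List ℚ) λ Q →
        IsPolyDegLead (sum (ks ∷ʳ kn)) (leadCoeff (ks ∷ʳ kn)) P
      × IsPolyDegLead (sum (ks ∷ʳ kn)) (leadCoeff (ks ∷ʳ kn)) Q
      × (∀ m → evalPoly P (fromℕℚ m) ≡ fromℕℚ (B (ks ∷ʳ kn) m))
      × (∀ m → evalPoly Q (fromℕℚ m) ≡ fromℕℚ (b (ks ∷ʳ kn) m))
      × (∀ j → j ≤ sum (ks ∷ʳ kn) ∸ length (ks ∷ʳ kn) → evalPoly P (- fromℕℚ j) ≡ 0ℚ)
      × (∀ x → evalPoly P x ≡ signℚ (sum (ks ∷ʳ kn)) *ℚ evalPoly Q (- x)))
    × (1 < kn →
        (∀ m → 1 ≤ m → B (ks ∷ʳ kn) m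
            ≡ sumTo m (λ i → i * B ks i * ((kn + m ∸ i ∸ 2) C (kn ∸ 2))))
      × (∀ m → 1 ≤ m → b (ks ∷ʳ kn) m
            ≡ sumTo (m ∸ 1) (λ i → i * b ks i * ((m ∸ i ∸ 1) C (kn ∸ 2)))))
    × (∀ m → B [] m ≡ 1)
    × B (ks ∷ʳ kn) 0 ≡ 0
    × (∀ m → 1 ≤ m →
          (1 < kn → B (ks ∷ʳ kn) m ≡ B (ks ∷ʳ kn) (m ∸ 1) + B (ks ∷ʳ (kn ∸ 1)) m)
        × (kn ≡ 1 → B (ks ∷ʳ kn) m ≡ m * B ks m))
    × (∀ m → b [] m ≡ 1)
    × b (ks ∷ʳ kn) 0 ≡ 0
    × (∀ m → 1 ≤ m →
          (1 < kn → b (ks ∷ʳ kn) m ≡ b (ks ∷ʳ kn) (m ∸ 1) + b (ks ∷ʳ (kn ∸ 1)) (m ∸ 1))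
        × (kn ≡ 1 → b (ks ∷ʳ kn) m ≡ m * b ks m))
theorem1 ks kn ks≥1 kn≥1 =
    polynomiality (Allₚ.∷ʳ⁺ ks≥1 kn≥1) (subst (0 <_) (sym (length-snoc ks kn)) (s≤s z≤n))
  , (λ 1<kn → (λ m _ → B-snoc-sum ks≥1 1<kn m) , (λ m → b-snoc-sum ks≥1 1<kn))
  , (λ _ → refl) , B-snoc-zero ks≥1 kn≥1
  , (λ { (suc m) _ → B-step kn m , λ { refl → B-snoc-one ks≥1 (suc m) } })
  , (λ _ → refl) , b-snoc-zero ks≥1 kn≥1
  , (λ { (suc m) _ → b-step kn m , λ { refl → b-snoc-one ks≥1 (suc m) } })
  where
  B-step : ∀ kn m → 1 < kn → B (ks ∷ʳ kn) (suc m) ≡ B (ks ∷ʳ kn) m + B (ks ∷ʳ (kn ∸ 1)) (suc m)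
  B-step (suc (suc k)) m (s≤s (s≤s z≤n)) = B-snoc-pascal ks≥1 k m
  b-step : ∀ kn m → 1 < kn → b (ks ∷ʳ kn) (suc m) ≡ b (ks ∷ʳ kn) m + b (ks ∷ʳ (kn ∸ 1)) m
  b-step (suc (suc k)) m (s≤s (s≤s z≤n)) = b-snoc-pascal ks≥1 k m
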